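{- Let $a(N)$ denote the number of Rascoe partitions of $N$ (partitions of $N$ into distinct parts in which the number of parts is itself a part), and let $b(N)$ denote the number of non-Rascoe partitions of $N$ (partitions of $N$ into distinct parts in which the number of parts is not a part). Then \begin{align*} \textup{(i)}\quad \sum_{N=1}^{\infty} a(N) q^N &= \sum_{n=1}^{\infty} q^{n(n+1)/2} \sum_{m=1}^{n} \left[\begin{matrix} n-1\\ m-1\end{matrix}\right]_q\frac{q^{m(m-1)}}{(q;q)_{m-1}},\\ \textup{(ii)}\quad \sum_{N=1}^{\infty} b(N) q^N &= \sum_{n=1}^{\infty} q^{n(n+1)/2} \sum_{m=1}^{n} \left[\begin{matrix} n-1\\ m-1\end{matrix}\right]_q \frac{q^{m^2}}{(q;q)_m}. \end{align*}
   Context: Here $|q|<1$, $(a;q)_0=1$, $(a;q)_n=(1-a)(1-aq)\cdots(1-aq^{n-1})$, and the Gaussian polynomial is $\left[\begin{matrix} N\\ n\end{matrix}\right]_q=\frac{(q;q)_N}{(q;q)_n(q;q)_{N-n}}$ if $0\le n\le N$ and $0$ otherwise. -}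

module Defs where

open import Data.Nat as ℕ using (ℕ; zero; suc; _≤_; _≤?_; _∸_)
open import Data.Nat.Divisibility using (_∣?_)
open import Data.Nat.DivMod using (_/_)
open import Data.Integer as ℤ using (ℤ; +_; -_)
open import Data.List using (List; length)
open import Data.Nat.ListAction using (sum)
open import Data.List.Relation.Unary.All using (All)
open import Data.List.Relation.Unary.Linked using (Linked)
open import Data.List.Relation.Unary.Unique.Propositional using (Unique)
open import Data.List.Membership.Propositional using (_∈_)
open import Data.Product using (Σ; _×_)
open import Function.Bundles using (_⇔_)
open import Relation.Binary.PropositionalEquality using (_≡_)
open import Relation.Nullary using (¬_; does)
open import Data.Bool using (if_then_else_)

-- Partitions into distinct parts.
-- A partition of N into distinct parts is represented canonically as a
-- strictly decreasing list of positive integers summing to N.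

record DistinctPartition (N : ℕ) (xs : List ℕ) : Set where
  field
    decreasing : Linked ℕ._>_ xs
    positive   : All (1 ≤_) xs
    sums       : sum xs ≡ N

Rascoe : ℕ → List ℕ → Set
Rascoe N xs = DistinctPartition N xs × (length xs ∈ xs)

NonRascoe : ℕ → List ℕ → Set
NonRascoe N xs = DistinctPartition N xs × ¬ (length xs ∈ xs)

HasCount : (List ℕ → Set) → ℤ → Set
HasCount P c =
  Σ (List (List ℕ)) λ L → Unique L × (∀ xs → (xs ∈ L) ⇔ P xs) × (+ length L ≡ c)

Series : Set
Series = ℕ → ℤ

sumBelow : ℕ → (ℕ → ℤ) → ℤ
sumBelow zero    f = + 0
sumBelow (suc n) f = sumBelow n f ℤ.+ f n

sumFrom1 : ℕ → (ℕ → ℤ) → ℤ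
sumFrom1 n f = sumBelow n (λ i → f (suc i))

one : Series
one zero    = + 1
one (suc _) = + 0

_⊛_ : Series → Series → Series
(f ⊛ g) n = sumBelow (suc n) (λ i → f i ℤ.* g (n ∸ i))

infixl 7 _⊛_

shift : ℕ → Series → Series
shift k f N = if does (k ≤? N) then f (N ∸ k) else + 0

oneMinusQ^ : ℕ → Series
oneMinusQ^ k N = one N ℤ.- (if does (k ℕ.≟ N) then + 1 else + 0)

-- 1 / (1 - q^k) = Σ_j q^{kj}   (k ≥ 1)
invOneMinusQ^ : ℕ → Series
invOneMinusQ^ k N = if does (k ∣? N) then + 1 else + 0

qPoch : ℕ → Series
qPoch zero    = one
qPoch (suc m) = qPoch m ⊛ oneMinusQ^ (suc m)

invQPoch : ℕ → Series
invQPoch zero    = one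
invQPoch (suc m) = invQPoch m ⊛ invOneMinusQ^ (suc m)

gauss : ℕ → ℕ → Series
gauss N n = if does (n ≤? N)
              then qPoch N ⊛ invQPoch n ⊛ invQPoch (N ∸ n)
              else (λ _ → + 0)

sumSeries1 : ℕ → (ℕ → Series) → Series
sumSeries1 n F N = sumFrom1 n (λ m → F m N)

tri : ℕ → ℕ
tri n = (n ℕ.* suc n) / 2

termA : ℕ → Series
termA n = shift (tri n)
  (sumSeries1 n (λ m → gauss (n ∸ 1) (m ∸ 1) ⊛ shift (m ℕ.* (m ∸ 1)) (invQPoch (m ∸ 1))))

termB : ℕ → Series
termB n = shift (tri n)
  (sumSeries1 n (λ m → gauss (n ∸ 1) (m ∸ 1) ⊛ shift (m ℕ.* m) (invQPoch m)))

-- Infinite sum Σ_{n ≥ 1} of such terms as a formal power series.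
-- termA n, termB n are divisible by q^{n(n+1)/2}, and n(n+1)/2 ≥ n, so only
-- n ≤ N contribute to the coefficient of q^N; this is the standard
-- (formal-topology) meaning of the infinite sum.
infSum1 : (ℕ → Series) → Series
infSum1 T N = sumFrom1 N (λ n → T n N)

rhsA : Series
rhsA = infSum1 termA

rhsB : Series
rhsB = infSum1 termB

-- Split a partition into n distinct parts at n: say k parts exceed n and the other n - k
-- lie in [1, n].  Up to degree N (so that the bound N on the parts is invisible) the large
-- parts have generating function q^(kn + k(k+1)/2) / (q;q)_k.  A Rascoe partition has n and
-- n - k - 1 further parts in [1, n - 1], giving q^n q^((n-k-1)(n-k)/2) [n-1, k]; a non-Rascoe
-- one has n - k parts in [1, n - 1], giving q^((n-k)(n-k+1)/2) [n-1, k-1].  The exponents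
-- add up to n(n+1)/2 + (k+1)k and n(n+1)/2 + k^2, the summands of (i) and (ii).
--
-- The splitting is proved through the q-Pascal recurrence F (k+1) (h+1) = F (k+1) h +
-- q^(h+1) F k h satisfied, for h ≥ t, by the generating function F k h of k distinct parts
-- from [1, h] whose membership condition only involves the parts up to t: the recurrence
-- determines F from F _ t, and the convolution of q^(it + i(i+1)/2) [h-t, i] with F _ t
-- satisfies it as well.

module Submission where

open import Defs
open import Data.Nat as ℕ using (ℕ; zero; suc; _+_; _*_; _∸_; _≤_; _<_; _>_; _≤?_; _<?_; z≤n; s≤s)
import Data.Nat.Properties as ℕP
open import Data.Nat.DivMod using (_/_; +-distrib-/-∣ˡ; m*n/n≡m)
open import Data.Nat.Divisibility using (_∣_; _∣?_; divides; ∣m+n∣m⇒∣n; ∣m∸n∣n⇒∣m; ∣⇒≤; ∣-refl)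
open import Data.Nat.ListAction using (sum)
import Data.Nat.Solver as ℕSolver
open import Data.Integer as ℤ using (ℤ; +_)
import Data.Integer.Properties as ℤP
open import Data.Integer.Solver using (module +-*-Solver)
open import Data.Bool using (if_then_else_; true; false)
open import Data.Unit using (tt)
open import Data.Product using (Σ; _×_; _,_; proj₁; proj₂)
open import Data.Sum using (inj₁; inj₂)
open import Data.List using (List; []; _∷_; _++_; map; length; filter)
import Data.List.Properties as ListP
open import Data.List.Relation.Unary.All as All using (All; []; _∷_)
import Data.List.Relation.Unary.All.Properties as AllP
open import Data.List.Relation.Unary.Any using (here; there)
open import Data.List.Relation.Unary.AllPairs as AllPairs using ([]; _∷_)
open import Data.List.Relation.Unary.Linked as Linked using (Linked; []; [-]; _∷_)
open import Data.List.Relation.Unary.Linked.Properties using (Linked⇒AllPairs)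
open import Data.List.Relation.Unary.Unique.Propositional using (Unique)
import Data.List.Relation.Unary.Unique.Propositional.Properties as UniqueP
open import Data.List.Membership.Propositional using (_∈_; _∉_)
open import Data.List.Membership.Propositional.Properties
  using (∈-++⁻; ∈-++⁺ˡ; ∈-++⁺ʳ; ∈-map⁻; ∈-map⁺; ∈-filter⁺; ∈-filter⁻)
open import Data.List.Membership.DecPropositional ℕP._≟_ using (_∈?_)
open import Function using (_∘_; _∘′_)
open import Function.Bundles using (_⇔_; mk⇔; Equivalence)
open import Level using (0ℓ)
open import Algebra.Bundles using (CommutativeRing)
import Algebra.Properties.CommutativeSemigroup as CommutativeSemigroupProperties
import Algebra.Properties.Group as GroupProperties
import Algebra.Solver.Ring.NaturalCoefficients.Default as NaturalCoefficientsSolver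
import Relation.Binary.Reasoning.Setoid as SetoidReasoning
open import Relation.Binary.Definitions using (tri<; tri≈; tri>)
open import Relation.Nullary using (Dec; does; yes; no; ¬_; contradiction)
open import Relation.Nullary.Decidable using (dec-true; dec-false; does-⇔)
open import Relation.Unary using (Pred; Decidable; U)
open import Relation.Unary.Properties using (U?; ∁?)
open import Relation.Binary.PropositionalEquality
  using (_≡_; _≢_; refl; sym; trans; cong; cong₂; subst; module ≡-Reasoning)

open CommutativeSemigroupProperties ℤP.+-commutativeSemigroup using () renaming (interchange to +-interchange)

-- Formal power series

sumBelow-cong : ∀ n {f g : ℕ → ℤ} → (∀ i → i < n → f i ≡ g i) → sumBelow n f ≡ sumBelow n g
sumBelow-cong zero    f≡g = refl
sumBelow-cong (suc n) f≡g =
  cong₂ ℤ._+_ (sumBelow-cong n (λ i i<n → f≡g i (ℕP.m<n⇒m<1+n i<n))) (f≡g n (ℕP.n<1+n n))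

sumBelow-zero : ∀ n {f : ℕ → ℤ} → (∀ i → i < n → f i ≡ + 0) → sumBelow n f ≡ + 0
sumBelow-zero zero    f≡0 = refl
sumBelow-zero (suc n) f≡0 =
  cong₂ ℤ._+_ (sumBelow-zero n (λ i i<n → f≡0 i (ℕP.m<n⇒m<1+n i<n))) (f≡0 n (ℕP.n<1+n n))

sumBelow-+ : ∀ n (f g : ℕ → ℤ) → sumBelow n (λ i → f i ℤ.+ g i) ≡ sumBelow n f ℤ.+ sumBelow n g
sumBelow-+ zero    f g = refl
sumBelow-+ (suc n) f g = begin
  sumBelow n (λ i → f i ℤ.+ g i) ℤ.+ (f n ℤ.+ g n)
    ≡⟨ cong (ℤ._+ (f n ℤ.+ g n)) (sumBelow-+ n f g) ⟩
  (sumBelow n f ℤ.+ sumBelow n g) ℤ.+ (f n ℤ.+ g n)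
    ≡⟨ +-interchange (sumBelow n f) (sumBelow n g) (f n) (g n) ⟩
  (sumBelow n f ℤ.+ f n) ℤ.+ (sumBelow n g ℤ.+ g n) ∎
  where open ≡-Reasoning

sumBelow-*ˡ : ∀ n c (f : ℕ → ℤ) → c ℤ.* sumBelow n f ≡ sumBelow n (λ i → c ℤ.* f i)
sumBelow-*ˡ zero    c f = ℤP.*-zeroʳ c
sumBelow-*ˡ (suc n) c f =
  trans (ℤP.*-distribˡ-+ c (sumBelow n f) (f n)) (cong (ℤ._+ c ℤ.* f n) (sumBelow-*ˡ n c f))

sumBelow-head : ∀ n (f : ℕ → ℤ) → sumBelow (suc n) f ≡ f 0 ℤ.+ sumBelow n (f ∘ suc)
sumBelow-head zero    f = ℤP.+-comm (+ 0) (f 0)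
sumBelow-head (suc n) f =
  trans (cong (ℤ._+ f (suc n)) (sumBelow-head n f)) (ℤP.+-assoc (f 0) (sumBelow n (f ∘ suc)) (f (suc n)))

sumBelow-reverse : ∀ n (f : ℕ → ℤ) → sumBelow n f ≡ sumBelow n (λ i → f (n ∸ suc i))
sumBelow-reverse zero    f = refl
sumBelow-reverse (suc n) f = begin
  sumBelow n f ℤ.+ f n                     ≡⟨ ℤP.+-comm (sumBelow n f) (f n) ⟩
  f n ℤ.+ sumBelow n f                     ≡⟨ cong (λ s → f n ℤ.+ s) (sumBelow-reverse n f) ⟩
  f n ℤ.+ sumBelow n (λ i → f (n ∸ suc i)) ≡⟨ sumBelow-head n (λ i → f (n ∸ i)) ⟨
  sumBelow (suc n) (λ i → f (n ∸ i))       ∎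
  where open ≡-Reasoning

infix  4 _≈_
infixl 6 _⊕_

_≈_ : Series → Series → Set
f ≈ g = ∀ N → f N ≡ g N

_⊕_ : Series → Series → Series
(f ⊕ g) N = f N ℤ.+ g N

⊝_ : Series → Series
(⊝ f) N = ℤ.- f N

𝟘 : Series
𝟘 _ = + 0

scale : ℤ → Series → Series
scale c f N = c ℤ.* f N

tail : Series → Series
tail f N = f (suc N)

≈-refl : ∀ {f} → f ≈ f
≈-refl N = refl

≈-reflexive : ∀ {f g} → f ≡ g → f ≈ g
≈-reflexive refl = ≈-refl

≈-sym : ∀ {f g} → f ≈ g → g ≈ f
≈-sym f≈g N = sym (f≈g N)

≈-trans : ∀ {f g h} → f ≈ g → g ≈ h → f ≈ h
≈-trans f≈g g≈h N = trans (f≈g N) (g≈h N)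

⊕-identityˡ : ∀ f → 𝟘 ⊕ f ≈ f
⊕-identityˡ f N = ℤP.+-identityˡ (f N)

⊕-identityʳ : ∀ f → f ⊕ 𝟘 ≈ f
⊕-identityʳ f N = ℤP.+-identityʳ (f N)

⊕-assoc : ∀ f g h → f ⊕ g ⊕ h ≈ f ⊕ (g ⊕ h)
⊕-assoc f g h N = ℤP.+-assoc (f N) (g N) (h N)

⊕-cong : ∀ {f f′ g g′} → f ≈ f′ → g ≈ g′ → f ⊕ g ≈ f′ ⊕ g′
⊕-cong f≈f′ g≈g′ N = cong₂ ℤ._+_ (f≈f′ N) (g≈g′ N)

⊕-congʳ : ∀ {f f′} g → f ≈ f′ → f ⊕ g ≈ f′ ⊕ g
⊕-congʳ g f≈f′ = ⊕-cong f≈f′ (≈-refl {g})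

⊕-congˡ : ∀ f {g g′} → g ≈ g′ → f ⊕ g ≈ f ⊕ g′
⊕-congˡ f = ⊕-cong (≈-refl {f})

⊛-cong : ∀ {f f′ g g′} → f ≈ f′ → g ≈ g′ → f ⊛ g ≈ f′ ⊛ g′
⊛-cong f≈f′ g≈g′ N = sumBelow-cong (suc N) (λ i _ → cong₂ ℤ._*_ (f≈f′ i) (g≈g′ (N ∸ i)))

⊛-congʳ : ∀ {f f′} g → f ≈ f′ → f ⊛ g ≈ f′ ⊛ g
⊛-congʳ g f≈f′ = ⊛-cong f≈f′ (≈-refl {g})

⊛-congˡ : ∀ f {g g′} → g ≈ g′ → f ⊛ g ≈ f ⊛ g′
⊛-congˡ f = ⊛-cong (≈-refl {f})

⊛-at-0 : ∀ f g → (f ⊛ g) 0 ≡ f 0 ℤ.* g 0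
⊛-at-0 f g = ℤP.+-identityˡ (f 0 ℤ.* g 0)

⊛-at-suc : ∀ f g N → (f ⊛ g) (suc N) ≡ f 0 ℤ.* g (suc N) ℤ.+ (tail f ⊛ g) N
⊛-at-suc f g N = sumBelow-head (suc N) (λ i → f i ℤ.* g (suc N ∸ i))

⊛-comm : ∀ f g → f ⊛ g ≈ g ⊛ f
⊛-comm f g N = trans (sumBelow-reverse (suc N) _) (sumBelow-cong (suc N) λ i i≤N →
  trans (cong (λ k → f (N ∸ i) ℤ.* g k) (ℕP.m∸[m∸n]≡n (ℕP.≤-pred i≤N))) (ℤP.*-comm (f (N ∸ i)) (g i)))

⊛-distribʳ : ∀ f g h → (f ⊕ g) ⊛ h ≈ f ⊛ h ⊕ g ⊛ h
⊛-distribʳ f g h N =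
  trans (sumBelow-cong (suc N) (λ i _ → ℤP.*-distribʳ-+ (h (N ∸ i)) (f i) (g i))) (sumBelow-+ (suc N) _ _)

⊛-distribˡ : ∀ h f g → h ⊛ (f ⊕ g) ≈ h ⊛ f ⊕ h ⊛ g
⊛-distribˡ h f g N =
  trans (⊛-comm h (f ⊕ g) N) (trans (⊛-distribʳ f g h N) (cong₂ ℤ._+_ (⊛-comm f h N) (⊛-comm g h N)))

scale-⊛ : ∀ c f g → scale c f ⊛ g ≈ scale c (f ⊛ g)
scale-⊛ c f g N =
  trans (sumBelow-cong (suc N) (λ i _ → ℤP.*-assoc c (f i) _)) (sym (sumBelow-*ˡ (suc N) c _))

tail-⊛ : ∀ f g → tail (f ⊛ g) ≈ scale (f 0) (tail g) ⊕ tail f ⊛ g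
tail-⊛ f g = ⊛-at-suc f g

-- By induction on the degree, using f = f 0 + q · tail f.
⊛-assoc : ∀ f g h → (f ⊛ g) ⊛ h ≈ f ⊛ (g ⊛ h)
⊛-assoc f g h zero = begin
  ((f ⊛ g) ⊛ h) 0       ≡⟨ ⊛-at-0 (f ⊛ g) h ⟩
  (f ⊛ g) 0 ℤ.* h 0     ≡⟨ cong (ℤ._* h 0) (⊛-at-0 f g) ⟩
  f 0 ℤ.* g 0 ℤ.* h 0   ≡⟨ ℤP.*-assoc (f 0) (g 0) (h 0) ⟩
  f 0 ℤ.* (g 0 ℤ.* h 0) ≡⟨ cong (f 0 ℤ.*_) (⊛-at-0 g h) ⟨
  f 0 ℤ.* (g ⊛ h) 0     ≡⟨ ⊛-at-0 f (g ⊛ h) ⟨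
  (f ⊛ (g ⊛ h)) 0       ∎
  where open ≡-Reasoning
⊛-assoc f g h (suc N) = begin
  ((f ⊛ g) ⊛ h) (suc N)
    ≡⟨ ⊛-at-suc (f ⊛ g) h N ⟩
  (f ⊛ g) 0 ℤ.* h (suc N) ℤ.+ (tail (f ⊛ g) ⊛ h) N
    ≡⟨ cong₂ ℤ._+_ (cong (ℤ._* h (suc N)) (⊛-at-0 f g))
                   (trans (⊛-congʳ h (tail-⊛ f g) N) (⊛-distribʳ (scale (f 0) (tail g)) (tail f ⊛ g) h N)) ⟩
  f 0 ℤ.* g 0 ℤ.* h (suc N) ℤ.+ ((scale (f 0) (tail g) ⊛ h) N ℤ.+ ((tail f ⊛ g) ⊛ h) N)
    ≡⟨ cong (λ s → f 0 ℤ.* g 0 ℤ.* h (suc N) ℤ.+ s)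
            (cong₂ ℤ._+_ (scale-⊛ (f 0) (tail g) h N) (⊛-assoc (tail f) g h N)) ⟩
  f 0 ℤ.* g 0 ℤ.* h (suc N) ℤ.+ (f 0 ℤ.* (tail g ⊛ h) N ℤ.+ (tail f ⊛ (g ⊛ h)) N)
    ≡⟨ solve 5 (λ a b c d e → a :* b :* c :+ (a :* d :+ e) := a :* (b :* c :+ d) :+ e) refl
               (f 0) (g 0) (h (suc N)) ((tail g ⊛ h) N) ((tail f ⊛ (g ⊛ h)) N) ⟩
  f 0 ℤ.* (g 0 ℤ.* h (suc N) ℤ.+ (tail g ⊛ h) N) ℤ.+ (tail f ⊛ (g ⊛ h)) N
    ≡⟨ cong (λ x → f 0 ℤ.* x ℤ.+ (tail f ⊛ (g ⊛ h)) N) (⊛-at-suc g h N) ⟨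
  f 0 ℤ.* (g ⊛ h) (suc N) ℤ.+ (tail f ⊛ (g ⊛ h)) N
    ≡⟨ ⊛-at-suc f (g ⊛ h) N ⟨
  (f ⊛ (g ⊛ h)) (suc N) ∎
  where
  open ≡-Reasoning
  open +-*-Solver

⊛-zeroˡ : ∀ f → 𝟘 ⊛ f ≈ 𝟘
⊛-zeroˡ f N = sumBelow-zero (suc N) (λ i _ → ℤP.*-zeroˡ (f (N ∸ i)))

⊛-zeroʳ : ∀ f → f ⊛ 𝟘 ≈ 𝟘
⊛-zeroʳ f = ≈-trans (⊛-comm f 𝟘) (⊛-zeroˡ f)

⊛-identityˡ : ∀ f → one ⊛ f ≈ f
⊛-identityˡ f zero    = trans (⊛-at-0 one f) (ℤP.*-identityˡ (f 0))
⊛-identityˡ f (suc N) = begin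
  (one ⊛ f) (suc N)                             ≡⟨ ⊛-at-suc one f N ⟩
  + 1 ℤ.* f (suc N) ℤ.+ (tail one ⊛ f) N         ≡⟨ cong₂ ℤ._+_ (ℤP.*-identityˡ (f (suc N))) (⊛-zeroˡ f N) ⟩
  f (suc N) ℤ.+ + 0                              ≡⟨ ℤP.+-identityʳ (f (suc N)) ⟩
  f (suc N)                                      ∎
  where open ≡-Reasoning

⊛-identityʳ : ∀ f → f ⊛ one ≈ f
⊛-identityʳ f = ≈-trans (⊛-comm f one) (⊛-identityˡ f)

seriesRing : CommutativeRing _ _
seriesRing = record
  { Carrier = Series ; _≈_ = _≈_ ; _+_ = _⊕_ ; _*_ = _⊛_ ; -_ = ⊝_ ; 0# = 𝟘 ; 1# = one
  ; isCommutativeRing = record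
    { isRing = record
      { +-isAbelianGroup = record
        { isGroup = record
          { isMonoid = record
            { isSemigroup = record
              { isMagma = record
                { isEquivalence = record { refl = ≈-refl ; sym = ≈-sym ; trans = ≈-trans }
                ; ∙-cong = ⊕-cong }
              ; assoc = ⊕-assoc }
            ; identity = ⊕-identityˡ , ⊕-identityʳ }
          ; inverse = (λ f N → ℤP.+-inverseˡ (f N)) , (λ f N → ℤP.+-inverseʳ (f N))
          ; ⁻¹-cong = λ f≈g N → cong ℤ.-_ (f≈g N) }
        ; comm = λ f g N → ℤP.+-comm (f N) (g N) }
      ; *-cong = ⊛-cong
      ; *-assoc = ⊛-assoc
      ; *-identity = ⊛-identityˡ , ⊛-identityʳ
      ; distrib = ⊛-distribˡ , (λ h f g → ⊛-distribʳ f g h) }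
    ; *-comm = ⊛-comm } }

open CommutativeRing seriesRing using (commutativeSemiring; *-commutativeSemigroup; +-group; setoid)
open CommutativeSemigroupProperties *-commutativeSemigroup
  using (xy∙z≈xz∙y; x∙yz≈y∙xz) renaming (interchange to ⊛-interchange)
open GroupProperties +-group using () renaming (∙-cancelʳ to ⊕-cancelʳ)
module ≈-Reasoning = SetoidReasoning setoid
module SeriesSolver = NaturalCoefficientsSolver commutativeSemiring

shift-≤ : ∀ {k N} f → k ≤ N → shift k f N ≡ f (N ∸ k)
shift-≤ {k} {N} f k≤N = cong (λ b → if b then f (N ∸ k) else + 0) (dec-true (k ≤? N) k≤N)

shift-< : ∀ {k N} f → N < k → shift k f N ≡ + 0
shift-< {k} {N} f N<k = cong (λ b → if b then f (N ∸ k) else + 0) (dec-false (k ≤? N) (ℕP.<⇒≱ N<k))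

shift-cong : ∀ k {f g} → f ≈ g → shift k f ≈ shift k g
shift-cong k f≈g N with k ℕ.≤ᵇ N
... | true  = f≈g (N ∸ k)
... | false = refl

shift-⊕ : ∀ k f g → shift k (f ⊕ g) ≈ shift k f ⊕ shift k g
shift-⊕ k f g N with k ℕ.≤ᵇ N
... | true  = refl
... | false = refl

shift-𝟘 : ∀ k → shift k 𝟘 ≈ 𝟘
shift-𝟘 k N with k ℕ.≤ᵇ N
... | true  = refl
... | false = refl

shift-suc : ∀ k f → shift (suc k) f ≈ shift 1 (shift k f)
shift-suc k f zero    = refl
shift-suc k f (suc N) with k ≤? N
... | yes k≤N = trans (shift-≤ f (s≤s k≤N)) (sym (shift-≤ f k≤N))
... | no  k≰N = trans (shift-< f (s≤s (ℕP.≰⇒> k≰N))) (sym (shift-< f (ℕP.≰⇒> k≰N)))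

shift-+ : ∀ a b f → shift a (shift b f) ≈ shift (a + b) f
shift-+ zero    b f = ≈-refl
shift-+ (suc a) b f = ≈-trans (shift-suc a (shift b f))
  (≈-trans (shift-cong 1 (shift-+ a b f)) (≈-sym (shift-suc (a + b) f)))

shift-1-⊛ : ∀ f g → shift 1 f ⊛ g ≈ shift 1 (f ⊛ g)
shift-1-⊛ f g zero    = trans (⊛-at-0 (shift 1 f) g) (ℤP.*-zeroˡ (g 0))
shift-1-⊛ f g (suc N) = trans (⊛-at-suc (shift 1 f) g N)
  (trans (cong (ℤ._+ (f ⊛ g) N) (ℤP.*-zeroˡ (g (suc N)))) (ℤP.+-identityˡ ((f ⊛ g) N)))

shift-⊛ˡ : ∀ k f g → shift k f ⊛ g ≈ shift k (f ⊛ g)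
shift-⊛ˡ zero    f g = ≈-refl
shift-⊛ˡ (suc k) f g = begin
  shift (suc k) f ⊛ g     ≈⟨ ⊛-congʳ g (shift-suc k f) ⟩
  shift 1 (shift k f) ⊛ g ≈⟨ shift-1-⊛ (shift k f) g ⟩
  shift 1 (shift k f ⊛ g) ≈⟨ shift-cong 1 (shift-⊛ˡ k f g) ⟩
  shift 1 (shift k (f ⊛ g)) ≈⟨ shift-suc k (f ⊛ g) ⟨
  shift (suc k) (f ⊛ g)   ∎
  where open ≈-Reasoning

shift-⊛ʳ : ∀ k f g → f ⊛ shift k g ≈ shift k (f ⊛ g)
shift-⊛ʳ k f g = ≈-trans (⊛-comm f (shift k g)) (≈-trans (shift-⊛ˡ k g f) (shift-cong k (⊛-comm g f)))

shift-⊛-shiftʳ : ∀ a b f g → shift a (f ⊛ shift b g) ≈ shift (a + b) (f ⊛ g)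
shift-⊛-shiftʳ a b f g = ≈-trans (shift-cong a (shift-⊛ʳ b f g)) (shift-+ a b (f ⊛ g))

shift-⊛-shift : ∀ a b f g → shift a f ⊛ shift b g ≈ shift (a + b) (f ⊛ g)
shift-⊛-shift a b f g = ≈-trans (shift-⊛ˡ a f (shift b g)) (shift-⊛-shiftʳ a b f g)

-- q-Pochhammer symbols and Gaussian polynomials

q^_ : ℕ → Series
q^ k = shift k one

shift≈q^-⊛ : ∀ k f → shift k f ≈ q^ k ⊛ f
shift≈q^-⊛ k f = ≈-sym (≈-trans (shift-⊛ˡ k one f) (shift-cong k (⊛-identityˡ f)))

q^-+ : ∀ a b → q^ a ⊛ q^ b ≈ q^ (a + b)
q^-+ a b = ≈-trans (shift-⊛-shift a b one one) (shift-cong (a + b) (⊛-identityˡ one))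

q^-self : ∀ k → (q^ k) k ≡ + 1
q^-self k = trans (shift-≤ one (ℕP.≤-refl {k})) (cong one (ℕP.n∸n≡0 k))

one-≢0 : ∀ {N} → N ≢ 0 → one N ≡ + 0
one-≢0 {zero}  N≢0 = contradiction refl N≢0
one-≢0 {suc N} _   = refl

q^-≢ : ∀ {k N} → k ≢ N → (q^ k) N ≡ + 0
q^-≢ {k} {N} k≢N with k ≤? N
... | yes k≤N =
  trans (shift-≤ one k≤N) (one-≢0 (λ N∸k≡0 → k≢N (ℕP.≤-antisym k≤N (ℕP.m∸n≡0⇒m≤n N∸k≡0))))
... | no  k≰N = shift-< one (ℕP.≰⇒> k≰N)

q^-indicator : ∀ k N → (if does (k ℕ.≟ N) then + 1 else + 0) ≡ (q^ k) N
q^-indicator k N with k ℕ.≟ N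
... | yes refl = trans (cong (λ b → if b then + 1 else + 0) (dec-true (k ℕ.≟ k) refl)) (sym (q^-self k))
... | no  k≢N  = trans (cong (λ b → if b then + 1 else + 0) (dec-false (k ℕ.≟ N) k≢N)) (sym (q^-≢ k≢N))

oneMinusQ^-⊕-q^ : ∀ k → oneMinusQ^ k ⊕ q^ k ≈ one
oneMinusQ^-⊕-q^ k N = trans (cong (λ x → one N ℤ.- x ℤ.+ (q^ k) N) (q^-indicator k N))
  (solve 2 (λ x y → x :- y :+ y := x) refl (one N) ((q^ k) N))
  where open +-*-Solver

oneMinusQ^-+ : ∀ a b → oneMinusQ^ a ⊕ q^ a ⊛ oneMinusQ^ b ≈ oneMinusQ^ (a + b)
oneMinusQ^-+ a b = ⊕-cancelʳ (q^ (a + b)) _ _ (begin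
  oneMinusQ^ a ⊕ q^ a ⊛ oneMinusQ^ b ⊕ q^ (a + b)      ≈⟨ ⊕-congˡ (oneMinusQ^ a ⊕ q^ a ⊛ oneMinusQ^ b) (q^-+ a b) ⟨
  oneMinusQ^ a ⊕ q^ a ⊛ oneMinusQ^ b ⊕ q^ a ⊛ q^ b     ≈⟨ solve 4 (λ v q w r → v :+ q :* w :+ q :* r := v :+ q :* (w :+ r)) ≈-refl
                                                            (oneMinusQ^ a) (q^ a) (oneMinusQ^ b) (q^ b) ⟩
  oneMinusQ^ a ⊕ q^ a ⊛ (oneMinusQ^ b ⊕ q^ b)          ≈⟨ ⊕-congˡ (oneMinusQ^ a) (⊛-congˡ (q^ a) (oneMinusQ^-⊕-q^ b)) ⟩
  oneMinusQ^ a ⊕ q^ a ⊛ one                            ≈⟨ ⊕-congˡ (oneMinusQ^ a) (⊛-identityʳ (q^ a)) ⟩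
  oneMinusQ^ a ⊕ q^ a                                  ≈⟨ oneMinusQ^-⊕-q^ a ⟩
  one                                                  ≈⟨ oneMinusQ^-⊕-q^ (a + b) ⟨
  oneMinusQ^ (a + b) ⊕ q^ (a + b)                      ∎)
  where
  open ≈-Reasoning
  open SeriesSolver

∣⇔∣∸ : ∀ {d n} → d ≤ n → d ∣ n ⇔ d ∣ n ∸ d
∣⇔∣∸ {d} d≤n = mk⇔ (λ d∣n → ∣m+n∣m⇒∣n (subst (d ∣_) (sym (ℕP.m+[n∸m]≡n d≤n)) d∣n) ∣-refl)
                    (λ d∣n∸d → ∣m∸n∣n⇒∣m d d≤n d∣n∸d ∣-refl)

invOneMinusQ^-unfold : ∀ k → invOneMinusQ^ (suc k) ≈ one ⊕ shift (suc k) (invOneMinusQ^ (suc k))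
invOneMinusQ^-unfold k zero    = refl
invOneMinusQ^-unfold k (suc N) with suc k ≤? suc N
... | yes 1+k≤1+N = begin
  invOneMinusQ^ (suc k) (suc N)                   ≡⟨ cong (λ b → if b then + 1 else + 0)
                                                       (does-⇔ (∣⇔∣∸ 1+k≤1+N) (suc k ∣? suc N) (suc k ∣? (N ∸ k))) ⟩
  invOneMinusQ^ (suc k) (N ∸ k)                   ≡⟨ shift-≤ (invOneMinusQ^ (suc k)) 1+k≤1+N ⟨
  shift (suc k) (invOneMinusQ^ (suc k)) (suc N)   ≡⟨ ℤP.+-identityˡ _ ⟨
  + 0 ℤ.+ shift (suc k) (invOneMinusQ^ (suc k)) (suc N) ∎
  where open ≡-Reasoning
... | no  1+k≰1+N = trans
  (cong (λ b → if b then + 1 else + 0) (dec-false (suc k ∣? suc N) (λ 1+k∣1+N → 1+k≰1+N (∣⇒≤ 1+k∣1+N))))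
  (cong (λ x → + 0 ℤ.+ x) (sym (shift-< (invOneMinusQ^ (suc k)) (ℕP.≰⇒> 1+k≰1+N))))

oneMinusQ^-⊛-invOneMinusQ^ : ∀ k → oneMinusQ^ (suc k) ⊛ invOneMinusQ^ (suc k) ≈ one
oneMinusQ^-⊛-invOneMinusQ^ k = ⊕-cancelʳ (q^ K ⊛ u) _ _ (begin
  oneMinusQ^ K ⊛ u ⊕ q^ K ⊛ u   ≈⟨ ⊛-distribʳ (oneMinusQ^ K) (q^ K) u ⟨
  (oneMinusQ^ K ⊕ q^ K) ⊛ u     ≈⟨ ⊛-congʳ u (oneMinusQ^-⊕-q^ K) ⟩
  one ⊛ u                       ≈⟨ ⊛-identityˡ u ⟩
  u                             ≈⟨ invOneMinusQ^-unfold k ⟩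
  one ⊕ shift K u               ≈⟨ ⊕-congˡ one (shift≈q^-⊛ K u) ⟩
  one ⊕ q^ K ⊛ u                ∎)
  where
  open ≈-Reasoning
  K : ℕ
  K = suc k
  u : Series
  u = invOneMinusQ^ K

qPoch-⊛-invQPoch : ∀ n → qPoch n ⊛ invQPoch n ≈ one
qPoch-⊛-invQPoch zero    = ⊛-identityˡ one
qPoch-⊛-invQPoch (suc n) = begin
  (qPoch n ⊛ v) ⊛ (invQPoch n ⊛ u)  ≈⟨ ⊛-interchange (qPoch n) v (invQPoch n) u ⟩
  (qPoch n ⊛ invQPoch n) ⊛ (v ⊛ u)  ≈⟨ ⊛-cong (qPoch-⊛-invQPoch n) (oneMinusQ^-⊛-invOneMinusQ^ n) ⟩
  one ⊛ one                         ≈⟨ ⊛-identityˡ one ⟩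
  one                               ∎
  where
  open ≈-Reasoning
  v u : Series
  v = oneMinusQ^ (suc n)
  u = invOneMinusQ^ (suc n)

gauss-≤ : ∀ M j → j ≤ M → gauss M j ≈ qPoch M ⊛ invQPoch j ⊛ invQPoch (M ∸ j)
gauss-≤ M j j≤M N =
  cong (λ b → (if b then qPoch M ⊛ invQPoch j ⊛ invQPoch (M ∸ j) else 𝟘) N) (dec-true (j ≤? M) j≤M)

gauss-> : ∀ M j → M < j → gauss M j ≈ 𝟘
gauss-> M j M<j N =
  cong (λ b → (if b then qPoch M ⊛ invQPoch j ⊛ invQPoch (M ∸ j) else 𝟘) N) (dec-false (j ≤? M) (ℕP.<⇒≱ M<j))

gauss-zero : ∀ M → gauss M 0 ≈ one
gauss-zero M = begin
  gauss M 0                       ≈⟨ gauss-≤ M 0 z≤n ⟩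
  qPoch M ⊛ one ⊛ invQPoch M      ≈⟨ ⊛-congʳ (invQPoch M) (⊛-identityʳ (qPoch M)) ⟩
  qPoch M ⊛ invQPoch M            ≈⟨ qPoch-⊛-invQPoch M ⟩
  one                             ∎
  where open ≈-Reasoning

gauss-diag : ∀ M → gauss M M ≈ one
gauss-diag M = begin
  gauss M M                                ≈⟨ gauss-≤ M M ℕP.≤-refl ⟩
  qPoch M ⊛ invQPoch M ⊛ invQPoch (M ∸ M)  ≈⟨ ⊛-congˡ (qPoch M ⊛ invQPoch M)
                                                        (≈-reflexive (cong invQPoch (ℕP.n∸n≡0 M))) ⟩
  qPoch M ⊛ invQPoch M ⊛ one               ≈⟨ ⊛-identityʳ _ ⟩
  qPoch M ⊛ invQPoch M                     ≈⟨ qPoch-⊛-invQPoch M ⟩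
  one                                      ∎
  where open ≈-Reasoning

gauss-sym : ∀ {M j} → j ≤ M → gauss M (M ∸ j) ≈ gauss M j
gauss-sym {M} {j} j≤M = begin
  gauss M (M ∸ j)                                      ≈⟨ gauss-≤ M (M ∸ j) (ℕP.m∸n≤m M j) ⟩
  qPoch M ⊛ invQPoch (M ∸ j) ⊛ invQPoch (M ∸ (M ∸ j))  ≈⟨ ⊛-congˡ (qPoch M ⊛ invQPoch (M ∸ j))
                                                           (≈-reflexive (cong invQPoch (ℕP.m∸[m∸n]≡n j≤M))) ⟩
  qPoch M ⊛ invQPoch (M ∸ j) ⊛ invQPoch j              ≈⟨ xy∙z≈xz∙y (qPoch M) (invQPoch (M ∸ j)) (invQPoch j) ⟩
  qPoch M ⊛ invQPoch j ⊛ invQPoch (M ∸ j)              ≈⟨ gauss-≤ M j j≤M ⟨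
  gauss M j                                            ∎
  where open ≈-Reasoning

partialFractions : ∀ a b →
  oneMinusQ^ (suc a + suc b) ⊛ invOneMinusQ^ (suc b) ⊛ invOneMinusQ^ (suc a)
    ≈ invOneMinusQ^ (suc b) ⊕ q^ (suc a) ⊛ invOneMinusQ^ (suc a)
partialFractions a b = begin
  oneMinusQ^ (suc a + suc b) ⊛ u ⊛ u′      ≈⟨ ⊛-congʳ u′ (⊛-congʳ u (oneMinusQ^-+ (suc a) (suc b))) ⟨
  (v′ ⊕ q^ (suc a) ⊛ v) ⊛ u ⊛ u′           ≈⟨ solve 5 (λ v′ Q v u u′ → (v′ :+ Q :* v) :* u :* u′
                                                           := u :* (v′ :* u′) :+ Q :* u′ :* (v :* u))
                                                ≈-refl v′ (q^ (suc a)) v u u′ ⟩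
  u ⊛ (v′ ⊛ u′) ⊕ q^ (suc a) ⊛ u′ ⊛ (v ⊛ u) ≈⟨ ⊕-cong (⊛-congˡ u (oneMinusQ^-⊛-invOneMinusQ^ a))
                                                      (⊛-congˡ (q^ (suc a) ⊛ u′) (oneMinusQ^-⊛-invOneMinusQ^ b)) ⟩
  u ⊛ one ⊕ q^ (suc a) ⊛ u′ ⊛ one          ≈⟨ ⊕-cong (⊛-identityʳ u) (⊛-identityʳ (q^ (suc a) ⊛ u′)) ⟩
  u ⊕ q^ (suc a) ⊛ u′                      ∎
  where
  open ≈-Reasoning
  open SeriesSolver
  v u v′ u′ : Series
  v = oneMinusQ^ (suc b)
  u = invOneMinusQ^ (suc b)
  v′ = oneMinusQ^ (suc a)
  u′ = invOneMinusQ^ (suc a)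

gauss-pascal-+ : ∀ j r → gauss (suc (j + suc r)) (suc j) ≈ gauss (j + suc r) (suc j) ⊕ shift (suc r) (gauss (j + suc r) j)
gauss-pascal-+ j r = begin
  gauss (suc M) (suc j)
    ≈⟨ gauss-≤ (suc M) (suc j) (s≤s (ℕP.m≤m+n j (suc r))) ⟩
  (P ⊛ v) ⊛ (I ⊛ u) ⊛ invQPoch (M ∸ j)
    ≈⟨ ⊛-congˡ ((P ⊛ v) ⊛ (I ⊛ u)) (≈-reflexive (cong invQPoch M∸j≡1+r)) ⟩
  (P ⊛ v) ⊛ (I ⊛ u) ⊛ (I′ ⊛ u′)
    ≈⟨ ⊛-congʳ (I′ ⊛ u′) (⊛-interchange P v I u) ⟩
  (P ⊛ I) ⊛ (v ⊛ u) ⊛ (I′ ⊛ u′)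
    ≈⟨ ⊛-interchange (P ⊛ I) (v ⊛ u) I′ u′ ⟩
  (P ⊛ I ⊛ I′) ⊛ (v ⊛ u ⊛ u′)
    ≈⟨ ⊛-congˡ (P ⊛ I ⊛ I′) (≈-trans (⊛-congʳ u′ (⊛-congʳ u (≈-reflexive (cong oneMinusQ^ 1+M≡1+r+1+j))))
                                      (partialFractions r j)) ⟩
  (P ⊛ I ⊛ I′) ⊛ (u ⊕ q^ (suc r) ⊛ u′)
    ≈⟨ ⊛-distribˡ (P ⊛ I ⊛ I′) u (q^ (suc r) ⊛ u′) ⟩
  (P ⊛ I ⊛ I′) ⊛ u ⊕ (P ⊛ I ⊛ I′) ⊛ (q^ (suc r) ⊛ u′)
    ≈⟨ ⊕-cong (≈-trans (xy∙z≈xz∙y (P ⊛ I) I′ u) (⊛-congʳ I′ (⊛-assoc P I u)))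
              (≈-trans (x∙yz≈y∙xz (P ⊛ I ⊛ I′) (q^ (suc r)) u′)
                       (⊛-congˡ (q^ (suc r)) (⊛-assoc (P ⊛ I) I′ u′))) ⟩
  P ⊛ (I ⊛ u) ⊛ I′ ⊕ q^ (suc r) ⊛ (P ⊛ I ⊛ (I′ ⊛ u′))
    ≈⟨ ⊕-cong (⊛-congˡ (P ⊛ (I ⊛ u)) (≈-reflexive (cong invQPoch (sym M∸1+j≡r))))
              (⊛-congˡ (q^ (suc r)) (⊛-congˡ (P ⊛ I) (≈-reflexive (cong invQPoch (sym M∸j≡1+r))))) ⟩
  P ⊛ invQPoch (suc j) ⊛ invQPoch (M ∸ suc j) ⊕ q^ (suc r) ⊛ (P ⊛ I ⊛ invQPoch (M ∸ j))
    ≈⟨ ⊕-cong (gauss-≤ M (suc j) 1+j≤M) (⊛-congˡ (q^ (suc r)) (gauss-≤ M j (ℕP.m≤m+n j (suc r)))) ⟨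
  gauss M (suc j) ⊕ q^ (suc r) ⊛ gauss M j
    ≈⟨ ⊕-congˡ (gauss M (suc j)) (shift≈q^-⊛ (suc r) (gauss M j)) ⟨
  gauss M (suc j) ⊕ shift (suc r) (gauss M j) ∎
  where
  open ≈-Reasoning
  M : ℕ
  M = j + suc r
  P v I u I′ u′ : Series
  P = qPoch M
  v = oneMinusQ^ (suc M)
  I = invQPoch j
  u = invOneMinusQ^ (suc j)
  I′ = invQPoch r
  u′ = invOneMinusQ^ (suc r)
  M∸j≡1+r : M ∸ j ≡ suc r
  M∸j≡1+r = ℕP.m+n∸m≡n j (suc r)
  M∸1+j≡r : M ∸ suc j ≡ r
  M∸1+j≡r = trans (cong (_∸ suc j) (ℕP.+-suc j r)) (ℕP.m+n∸m≡n j r)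
  1+j≤M : suc j ≤ M
  1+j≤M = ℕP.≤-trans (s≤s (ℕP.m≤m+n j r)) (ℕP.≤-reflexive (sym (ℕP.+-suc j r)))
  1+M≡1+r+1+j : suc M ≡ suc r + suc j
  1+M≡1+r+1+j = cong suc (trans (ℕP.+-suc j r) (ℕP.+-comm (suc j) r))

gauss-pascal : ∀ M j → gauss (suc M) (suc j) ≈ gauss M (suc j) ⊕ shift (M ∸ j) (gauss M j)
gauss-pascal M j with ℕP.<-cmp j M
... | tri< j<M _ _ = subst (λ M → gauss (suc M) (suc j) ≈ gauss M (suc j) ⊕ shift (M ∸ j) (gauss M j)) j+1+r≡M
  (≈-trans (gauss-pascal-+ j r)
           (⊕-congˡ (gauss (j + suc r) (suc j))
                    (≈-reflexive (cong (λ k → shift k (gauss (j + suc r) j)) (sym (ℕP.m+n∸m≡n j (suc r)))))))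
  where
  r : ℕ
  r = M ∸ suc j
  j+1+r≡M : j + suc r ≡ M
  j+1+r≡M = trans (ℕP.+-suc j r) (ℕP.m+[n∸m]≡n j<M)
... | tri≈ _ refl _ = begin
  gauss (suc M) (suc M)                       ≈⟨ gauss-diag (suc M) ⟩
  one                                         ≈⟨ gauss-diag M ⟨
  gauss M M                                   ≈⟨ ≈-reflexive (cong (λ k → shift k (gauss M M)) (ℕP.n∸n≡0 M)) ⟨
  shift (M ∸ M) (gauss M M)                   ≈⟨ ⊕-identityˡ _ ⟨
  𝟘 ⊕ shift (M ∸ M) (gauss M M)               ≈⟨ ⊕-congʳ (shift (M ∸ M) (gauss M M)) (gauss-> M (suc M) (ℕP.n<1+n M)) ⟨
  gauss M (suc M) ⊕ shift (M ∸ M) (gauss M M) ∎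
  where open ≈-Reasoning
... | tri> _ _ M<j = begin
  gauss (suc M) (suc j)                       ≈⟨ gauss-> (suc M) (suc j) (s≤s M<j) ⟩
  𝟘                                           ≈⟨ ⊕-cong (gauss-> M (suc j) (ℕP.m<n⇒m<1+n M<j))
                                                         (≈-trans (shift-cong (M ∸ j) (gauss-> M j M<j)) (shift-𝟘 (M ∸ j))) ⟨
  gauss M (suc j) ⊕ shift (M ∸ j) (gauss M j) ∎
  where open ≈-Reasoning

-- Generating functions of sets of distinct parts

tri-suc : ∀ n → tri (suc n) ≡ suc n + tri n
tri-suc n = begin
  (suc n * suc (suc n)) / 2        ≡⟨ cong (_/ 2) (solve 1 (λ n → (con 1 :+ n) :* (con 2 :+ n)
                                                              := (con 1 :+ n) :* con 2 :+ n :* (con 1 :+ n)) refl n) ⟩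
  (suc n * 2 + n * suc n) / 2      ≡⟨ +-distrib-/-∣ˡ (n * suc n) (divides (suc n) refl) ⟩
  suc n * 2 / 2 + n * suc n / 2    ≡⟨ cong (_+ tri n) (m*n/n≡m (suc n) 2) ⟩
  suc n + tri n                    ∎
  where
  open ≡-Reasoning
  open ℕSolver.+-*-Solver

tri-+ : ∀ a b → tri (a + b) ≡ tri a + tri b + a * b
tri-+ zero    b = sym (ℕP.+-identityʳ (tri b))
tri-+ (suc a) b = begin
  tri (suc (a + b))                        ≡⟨ tri-suc (a + b) ⟩
  suc (a + b) + tri (a + b)                ≡⟨ cong (λ x → suc (a + b) + x) (tri-+ a b) ⟩
  suc (a + b) + (tri a + tri b + a * b)    ≡⟨ solve 4 (λ a b ta tb → con 1 :+ (a :+ b) :+ (ta :+ tb :+ a :* b)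
                                                        := (con 1 :+ a :+ ta) :+ tb :+ (con 1 :+ a) :* b) refl a b (tri a) (tri b) ⟩
  (suc a + tri a) + tri b + suc a * b      ≡⟨ cong (λ x → x + tri b + suc a * b) (tri-suc a) ⟨
  tri (suc a) + tri b + suc a * b          ∎
  where
  open ≡-Reasoning
  open ℕSolver.+-*-Solver

n≤tri : ∀ k → k ≤ tri k
n≤tri zero    = z≤n
n≤tri (suc k) = ℕP.≤-trans (ℕP.m≤m+n (suc k) (tri k)) (ℕP.≤-reflexive (sym (tri-suc k)))

sumSeries : ℕ → (ℕ → Series) → Series
sumSeries n F N = sumBelow n (λ i → F i N)

sumSeries-cong : ∀ n {F G : ℕ → Series} → (∀ i → i < n → F i ≈ G i) → sumSeries n F ≈ sumSeries n G
sumSeries-cong n F≈G N = sumBelow-cong n (λ i i<n → F≈G i i<n N)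

sumSeries-zero : ∀ n {F : ℕ → Series} → (∀ i → i < n → F i ≈ 𝟘) → sumSeries n F ≈ 𝟘
sumSeries-zero n F≈0 N = sumBelow-zero n (λ i i<n → F≈0 i i<n N)

sumSeries-head : ∀ n (F : ℕ → Series) → sumSeries (suc n) F ≈ F 0 ⊕ sumSeries n (F ∘ suc)
sumSeries-head n F N = sumBelow-head n (λ i → F i N)

sumSeries-⊕ : ∀ n (F G : ℕ → Series) → sumSeries n (λ i → F i ⊕ G i) ≈ sumSeries n F ⊕ sumSeries n G
sumSeries-⊕ n F G N = sumBelow-+ n (λ i → F i N) (λ i → G i N)

shift-sumSeries : ∀ k n (F : ℕ → Series) → shift k (sumSeries n F) ≈ sumSeries n (λ i → shift k (F i))
shift-sumSeries k n F N with k ≤? N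
... | yes k≤N = trans (shift-≤ (sumSeries n F) k≤N) (sumBelow-cong n (λ i _ → sym (shift-≤ (F i) k≤N)))
... | no  k≰N = trans (shift-< (sumSeries n F) (ℕP.≰⇒> k≰N))
                      (sym (sumBelow-zero n (λ i _ → shift-< (F i) (ℕP.≰⇒> k≰N))))

-- F k h is a family of generating functions of k-element sets of parts bounded by h:
-- above t, raising the bound to h + 1 either leaves the part h + 1 out or puts it in.
record PascalAbove (t : ℕ) (F : ℕ → ℕ → Series) : Set where
  field
    pascal-zero : ∀ {h} → t ≤ h → F 0 (suc h) ≈ F 0 h
    pascal-suc  : ∀ {k h} → t ≤ h → F (suc k) (suc h) ≈ F (suc k) h ⊕ shift (suc h) (F k h)

open PascalAbove

pascalAbove-unique : ∀ {t F G} → PascalAbove t F → PascalAbove t G → (∀ k → F k t ≈ G k t) →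
                     ∀ d k → F k (d + t) ≈ G k (d + t)
pascalAbove-unique PF PG F≈G zero    k       = F≈G k
pascalAbove-unique {t} {F} {G} PF PG F≈G (suc d) zero = begin
  F 0 (suc (d + t))  ≈⟨ pascal-zero PF (ℕP.m≤n+m t d) ⟩
  F 0 (d + t)        ≈⟨ pascalAbove-unique PF PG F≈G d 0 ⟩
  G 0 (d + t)        ≈⟨ pascal-zero PG (ℕP.m≤n+m t d) ⟨
  G 0 (suc (d + t))  ∎
  where open ≈-Reasoning
pascalAbove-unique {t} {F} {G} PF PG F≈G (suc d) (suc k) = begin
  F (suc k) (suc (d + t))                           ≈⟨ pascal-suc PF (ℕP.m≤n+m t d) ⟩
  F (suc k) (d + t) ⊕ shift (suc (d + t)) (F k (d + t))
    ≈⟨ ⊕-cong (pascalAbove-unique PF PG F≈G d (suc k)) (shift-cong (suc (d + t)) (pascalAbove-unique PF PG F≈G d k)) ⟩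
  G (suc k) (d + t) ⊕ shift (suc (d + t)) (G k (d + t)) ≈⟨ pascal-suc PG (ℕP.m≤n+m t d) ⟨
  G (suc k) (suc (d + t))                           ∎
  where open ≈-Reasoning

convolve : (ℕ → ℕ → Series) → (ℕ → Series) → ℕ → ℕ → Series
convolve W g k h = sumSeries (suc k) (λ i → W i h ⊛ g (k ∸ i))

pascalAbove-convolve : ∀ {t W} → PascalAbove t W → (g : ℕ → Series) → PascalAbove t (convolve W g)
pascal-zero (pascalAbove-convolve PW g) t≤h N = cong (λ x → + 0 ℤ.+ x) (⊛-congʳ (g 0) (pascal-zero PW t≤h) N)
pascal-suc  (pascalAbove-convolve {t} {W} PW g) {k} {h} t≤h = begin
  convolve W g (suc k) (suc h)
    ≈⟨ sumSeries-head (suc k) (λ i → W i (suc h) ⊛ g (suc k ∸ i)) ⟩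
  W 0 (suc h) ⊛ g (suc k) ⊕ sumSeries (suc k) (λ i → W (suc i) (suc h) ⊛ g (k ∸ i))
    ≈⟨ ⊕-cong (⊛-congʳ (g (suc k)) (pascal-zero PW t≤h)) (sumSeries-cong (suc k) (λ i _ → step i)) ⟩
  A ⊕ sumSeries (suc k) (λ i → B i ⊕ shift (suc h) (C i))
    ≈⟨ ⊕-congˡ A (sumSeries-⊕ (suc k) B (λ i → shift (suc h) (C i))) ⟩
  A ⊕ (sumSeries (suc k) B ⊕ sumSeries (suc k) (λ i → shift (suc h) (C i)))
    ≈⟨ ⊕-assoc A (sumSeries (suc k) B) _ ⟨
  A ⊕ sumSeries (suc k) B ⊕ sumSeries (suc k) (λ i → shift (suc h) (C i))
    ≈⟨ ⊕-cong (≈-sym (sumSeries-head (suc k) (λ i → W i h ⊛ g (suc k ∸ i))))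
              (≈-sym (shift-sumSeries (suc h) (suc k) C)) ⟩
  convolve W g (suc k) h ⊕ shift (suc h) (convolve W g k h) ∎
  where
  open ≈-Reasoning
  A : Series
  A = W 0 h ⊛ g (suc k)
  B C : ℕ → Series
  B i = W (suc i) h ⊛ g (k ∸ i)
  C i = W i h ⊛ g (k ∸ i)
  step : ∀ i → W (suc i) (suc h) ⊛ g (k ∸ i) ≈ B i ⊕ shift (suc h) (C i)
  step i = ≈-trans (⊛-congʳ (g (k ∸ i)) (pascal-suc PW t≤h))
                   (≈-trans (⊛-distribʳ (W (suc i) h) (shift (suc h) (W i h)) (g (k ∸ i)))
                            (⊕-congˡ (B i) (shift-⊛ˡ (suc h) (W i h) (g (k ∸ i)))))

-- q^(k t + k(k+1)/2) [h - t, k], the generating function of k distinct parts from (t, h]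
partsIn : ℕ → ℕ → ℕ → Series
partsIn t k h = shift (k * t + tri k) (gauss (h ∸ t) k)

partsIn-zero : ∀ t h → partsIn t 0 h ≈ one
partsIn-zero t h = gauss-zero (h ∸ t)

partsIn-empty : ∀ t k → partsIn t (suc k) t ≈ 𝟘
partsIn-empty t k = ≈-trans (shift-cong (suc k * t + tri (suc k)) gauss-t∸t≈𝟘) (shift-𝟘 (suc k * t + tri (suc k)))
  where
  gauss-t∸t≈𝟘 : gauss (t ∸ t) (suc k) ≈ 𝟘
  gauss-t∸t≈𝟘 = ≈-trans (≈-reflexive (cong (λ m → gauss m (suc k)) (ℕP.n∸n≡0 t))) (gauss-> 0 (suc k) (s≤s z≤n))

shift-gauss-cong : ∀ {a b} M k → (k ≤ M → a ≡ b) → shift a (gauss M k) ≈ shift b (gauss M k)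
shift-gauss-cong {a} {b} M k a≡b with k ≤? M
... | yes k≤M = ≈-reflexive (cong (λ e → shift e (gauss M k)) (a≡b k≤M))
... | no  k≰M = ≈-trans (shift-cong a (gauss-> M k (ℕP.≰⇒> k≰M)))
                (≈-trans (shift-𝟘 a) (≈-sym (≈-trans (shift-cong b (gauss-> M k (ℕP.≰⇒> k≰M))) (shift-𝟘 b))))

partsIn-exponent : ∀ t k d → suc k * t + tri (suc k) + d ≡ suc (k + d + t) + (k * t + tri k)
partsIn-exponent t k d = begin
  suc k * t + tri (suc k) + d          ≡⟨ cong (λ x → suc k * t + x + d) (tri-suc k) ⟩
  suc k * t + (suc k + tri k) + d      ≡⟨ solve 4 (λ t k d T → (con 1 :+ k) :* t :+ (con 1 :+ k :+ T) :+ d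
                                                     := con 1 :+ (k :+ d :+ t) :+ (k :* t :+ T)) refl t k d (tri k) ⟩
  suc (k + d + t) + (k * t + tri k)    ∎
  where
  open ≡-Reasoning
  open ℕSolver.+-*-Solver

partsIn-pascal : ∀ t → PascalAbove t (partsIn t)
pascal-zero (partsIn-pascal t) {h} t≤h = ≈-trans (partsIn-zero t (suc h)) (≈-sym (partsIn-zero t h))
pascal-suc  (partsIn-pascal t) {k} {h} t≤h = begin
  shift E (gauss (suc h ∸ t) (suc k))
    ≈⟨ shift-cong E (≈-reflexive (cong (λ m → gauss m (suc k)) (ℕP.+-∸-assoc 1 t≤h))) ⟩
  shift E (gauss (suc M) (suc k))
    ≈⟨ shift-cong E (gauss-pascal M k) ⟩
  shift E (gauss M (suc k) ⊕ shift (M ∸ k) (gauss M k))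
    ≈⟨ shift-⊕ E (gauss M (suc k)) (shift (M ∸ k) (gauss M k)) ⟩
  shift E (gauss M (suc k)) ⊕ shift E (shift (M ∸ k) (gauss M k))
    ≈⟨ ⊕-congˡ (shift E (gauss M (suc k))) (shift-+ E (M ∸ k) (gauss M k)) ⟩
  shift E (gauss M (suc k)) ⊕ shift (E + (M ∸ k)) (gauss M k)
    ≈⟨ ⊕-congˡ (shift E (gauss M (suc k))) (shift-gauss-cong M k exponent) ⟩
  shift E (gauss M (suc k)) ⊕ shift (suc h + E′) (gauss M k)
    ≈⟨ ⊕-congˡ (shift E (gauss M (suc k))) (shift-+ (suc h) E′ (gauss M k)) ⟨
  shift E (gauss M (suc k)) ⊕ shift (suc h) (shift E′ (gauss M k)) ∎
  where
  open ≈-Reasoning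
  M E E′ : ℕ
  M = h ∸ t
  E = suc k * t + tri (suc k)
  E′ = k * t + tri k
  exponent : k ≤ M → E + (M ∸ k) ≡ suc h + E′
  exponent k≤M = trans (partsIn-exponent t k (M ∸ k))
    (cong (λ m → suc m + E′) (trans (cong (_+ t) (ℕP.m+[n∸m]≡n k≤M)) (ℕP.m∸n+n≡m t≤h)))

pascalAbove-expand : ∀ {t F} → PascalAbove t F → ∀ d k →
                     F k (d + t) ≈ sumSeries (suc k) (λ i → partsIn t i (d + t) ⊛ F (k ∸ i) t)
pascalAbove-expand {t} {F} PF = pascalAbove-unique PF (pascalAbove-convolve (partsIn-pascal t) (λ j → F j t)) base
  where
  base : ∀ k → F k t ≈ convolve (partsIn t) (λ j → F j t) k t
  base k = ≈-sym (begin
    sumSeries (suc k) (λ i → partsIn t i t ⊛ F (k ∸ i) t)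
      ≈⟨ sumSeries-head k (λ i → partsIn t i t ⊛ F (k ∸ i) t) ⟩
    partsIn t 0 t ⊛ F k t ⊕ sumSeries k (λ i → partsIn t (suc i) t ⊛ F (k ∸ suc i) t)
      ≈⟨ ⊕-cong (≈-trans (⊛-congʳ (F k t) (partsIn-zero t t)) (⊛-identityˡ (F k t)))
                (sumSeries-zero k (λ i _ → ≈-trans (⊛-congʳ (F (k ∸ suc i) t) (partsIn-empty t i))
                                                   (⊛-zeroˡ (F (k ∸ suc i) t)))) ⟩
    F k t ⊕ 𝟘
      ≈⟨ ⊕-identityʳ (F k t) ⟩
    F k t ∎)
    where open ≈-Reasoning

-- Truncation

Agree : ℕ → Series → Series → Set
Agree s f g = ∀ d → d ≤ s → f d ≡ g d

⊛-agree : ∀ s {f f′ g g′} → Agree s f f′ → Agree s g g′ → Agree s (f ⊛ g) (f′ ⊛ g′)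
⊛-agree s f≡f′ g≡g′ d d≤s = sumBelow-cong (suc d) (λ i i≤d →
  cong₂ ℤ._*_ (f≡f′ i (ℕP.≤-trans (ℕP.≤-pred i≤d) d≤s)) (g≡g′ (d ∸ i) (ℕP.≤-trans (ℕP.m∸n≤m d i) d≤s)))

⊛-agreeˡ : ∀ s {f f′} g → Agree s f f′ → Agree s (f ⊛ g) (f′ ⊛ g)
⊛-agreeˡ s g f≡f′ = ⊛-agree s {g = g} f≡f′ (λ _ _ → refl)

qPochFrom : ℕ → ℕ → Series
qPochFrom s zero    = one
qPochFrom s (suc k) = qPochFrom s k ⊛ oneMinusQ^ (suc (s + k))

qPoch-+ : ∀ s k → qPoch (s + k) ≈ qPoch s ⊛ qPochFrom s k
qPoch-+ s zero    = ≈-trans (≈-reflexive (cong qPoch (ℕP.+-identityʳ s))) (≈-sym (⊛-identityʳ (qPoch s)))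
qPoch-+ s (suc k) = begin
  qPoch (s + suc k)                                  ≈⟨ ≈-reflexive (cong qPoch (ℕP.+-suc s k)) ⟩
  qPoch (s + k) ⊛ oneMinusQ^ (suc (s + k))           ≈⟨ ⊛-congʳ (oneMinusQ^ (suc (s + k))) (qPoch-+ s k) ⟩
  qPoch s ⊛ qPochFrom s k ⊛ oneMinusQ^ (suc (s + k)) ≈⟨ ⊛-assoc (qPoch s) (qPochFrom s k) (oneMinusQ^ (suc (s + k))) ⟩
  qPoch s ⊛ qPochFrom s (suc k)                      ∎
  where open ≈-Reasoning

oneMinusQ^-agree : ∀ {s k} → s < k → Agree s (oneMinusQ^ k) one
oneMinusQ^-agree {s} {k} s<k d d≤s = begin
  oneMinusQ^ k d                                  ≡⟨ cong (λ x → one d ℤ.- x) (q^-indicator k d) ⟩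
  one d ℤ.- (q^ k) d                              ≡⟨ cong (λ x → one d ℤ.- x) (q^-≢ k≢d) ⟩
  one d ℤ.+ + 0                                   ≡⟨ ℤP.+-identityʳ (one d) ⟩
  one d                                           ∎
  where
  open ≡-Reasoning
  k≢d : k ≢ d
  k≢d k≡d = ℕP.<⇒≱ s<k (subst (_≤ s) (sym k≡d) d≤s)

qPochFrom-agree : ∀ s k → Agree s (qPochFrom s k) one
qPochFrom-agree s zero    d d≤s = refl
qPochFrom-agree s (suc k) d d≤s =
  trans (⊛-agree s (qPochFrom-agree s k) (oneMinusQ^-agree (s≤s (ℕP.m≤m+n s k))) d d≤s) (⊛-identityˡ one d)

gauss≈qPochFrom : ∀ M k → k ≤ M → gauss M k ≈ qPochFrom (M ∸ k) k ⊛ invQPoch k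
gauss≈qPochFrom M k k≤M = begin
  gauss M k
    ≈⟨ gauss-≤ M k k≤M ⟩
  qPoch M ⊛ invQPoch k ⊛ invQPoch s
    ≈⟨ ⊛-congʳ (invQPoch s) (⊛-congʳ (invQPoch k)
         (≈-trans (≈-reflexive (cong qPoch (sym (ℕP.m∸n+n≡m k≤M)))) (qPoch-+ s k))) ⟩
  qPoch s ⊛ qPochFrom s k ⊛ invQPoch k ⊛ invQPoch s
    ≈⟨ solve 4 (λ a b c d → a :* b :* c :* d := (a :* d) :* (b :* c)) ≈-refl
               (qPoch s) (qPochFrom s k) (invQPoch k) (invQPoch s) ⟩
  (qPoch s ⊛ invQPoch s) ⊛ (qPochFrom s k ⊛ invQPoch k)
    ≈⟨ ⊛-congʳ (qPochFrom s k ⊛ invQPoch k) (qPoch-⊛-invQPoch s) ⟩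
  one ⊛ (qPochFrom s k ⊛ invQPoch k)
    ≈⟨ ⊛-identityˡ (qPochFrom s k ⊛ invQPoch k) ⟩
  qPochFrom s k ⊛ invQPoch k ∎
  where
  open ≈-Reasoning
  open SeriesSolver
  s : ℕ
  s = M ∸ k

gauss-agree : ∀ M k → k ≤ M → Agree (M ∸ k) (gauss M k) (invQPoch k)
gauss-agree M k k≤M d d≤M∸k = begin
  gauss M k d                             ≡⟨ gauss≈qPochFrom M k k≤M d ⟩
  (qPochFrom (M ∸ k) k ⊛ invQPoch k) d    ≡⟨ ⊛-agreeˡ (M ∸ k) (invQPoch k) (qPochFrom-agree (M ∸ k) k) d d≤M∸k ⟩
  (one ⊛ invQPoch k) d                    ≡⟨ ⊛-identityˡ (invQPoch k) d ⟩
  invQPoch k d                            ∎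
  where open ≡-Reasoning

-- q^(k t + k(k+1)/2) / (q;q)_k, the generating function of k distinct parts greater than t
partsAbove : ℕ → ℕ → Series
partsAbove t k = shift (k * t + tri k) (invQPoch k)

partsIn-agree : ∀ t k h → Agree h (partsIn t k h) (partsAbove t k)
partsIn-agree t zero    h d d≤h = gauss-zero (h ∸ t) d
partsIn-agree t (suc i) h d d≤h with d <? suc i * t + tri (suc i)
... | yes d<E = trans (shift-< (gauss (h ∸ t) (suc i)) d<E) (sym (shift-< (invQPoch (suc i)) d<E))
... | no  d≮E = begin
  partsIn t k h d               ≡⟨ shift-≤ (gauss (h ∸ t) k) E≤d ⟩
  gauss (h ∸ t) k (d ∸ E)       ≡⟨ gauss-agree (h ∸ t) k k≤h∸t (d ∸ E) d∸E≤ ⟩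
  invQPoch k (d ∸ E)            ≡⟨ shift-≤ (invQPoch k) E≤d ⟨
  partsAbove t k d              ∎
  where
  open ≡-Reasoning
  k E : ℕ
  k = suc i
  E = k * t + tri k
  E≤d : E ≤ d
  E≤d = ℕP.≮⇒≥ d≮E
  t+k≤E : t + k ≤ E
  t+k≤E = ℕP.+-mono-≤ (ℕP.m≤m+n t (i * t)) (n≤tri k)
  k≤h∸t : k ≤ h ∸ t
  k≤h∸t = ℕP.m+n≤o⇒m≤o∸n k (ℕP.≤-trans (ℕP.≤-reflexive (ℕP.+-comm k t))
                                       (ℕP.≤-trans t+k≤E (ℕP.≤-trans E≤d d≤h)))
  d∸E≤ : d ∸ E ≤ h ∸ t ∸ k
  d∸E≤ = ℕP.≤-trans (ℕP.∸-mono d≤h t+k≤E) (ℕP.≤-reflexive (sym (ℕP.∸-+-assoc h t k)))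

-- Partitions into distinct parts

provided : ∀ {P : Set} → Dec P → List (List ℕ) → List (List ℕ)
provided (yes _) L = L
provided (no  _) _ = []

-- all strictly decreasing lists of k parts from [1, h] with sum a
distinctLists : ℕ → ℕ → ℕ → List (List ℕ)
distinctLists zero    h       zero    = [] ∷ []
distinctLists zero    h       (suc a) = []
distinctLists (suc k) zero    a       = []
distinctLists (suc k) (suc h) a       =
  distinctLists (suc k) h a ++ provided (suc h ≤? a) (map (suc h ∷_) (distinctLists k h (a ∸ suc h)))

record DistinctParts (k h a : ℕ) (xs : List ℕ) : Set where
  constructor distinctParts
  field
    partition : DistinctPartition a xs
    bounded   : All (_≤ h) xs
    parts     : length xs ≡ k

open DistinctParts
open DistinctPartition

head-dominates : ∀ {x ys} → Linked _>_ (x ∷ ys) → All (_< x) ys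
head-dominates = AllPairs.head ∘′ Linked⇒AllPairs (λ x>y y>z → ℕP.<-trans y>z x>y)

distinctParts-weaken : ∀ {k h a xs} → DistinctParts k h a xs → DistinctParts k (suc h) a xs
distinctParts-weaken (distinctParts p b l) = distinctParts p (All.map ℕP.m≤n⇒m≤1+n b) l

distinctParts-strengthen : ∀ {k h a x ys} → x ≤ h → DistinctParts k (suc h) a (x ∷ ys) → DistinctParts k h a (x ∷ ys)
distinctParts-strengthen x≤h (distinctParts p _ l) =
  distinctParts p (x≤h ∷ All.map (λ y<x → ℕP.≤-trans (ℕP.<⇒≤ y<x) x≤h) (head-dominates (decreasing p))) l

distinctParts-∷ : ∀ {k h a ys} → suc h ≤ a →
                  DistinctParts k h (a ∸ suc h) ys → DistinctParts (suc k) (suc h) a (suc h ∷ ys)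
distinctParts-∷ {h = h} {ys = ys} 1+h≤a (distinctParts p b l) = distinctParts
  (record { decreasing = linked ys (decreasing p) b
          ; positive   = s≤s z≤n ∷ positive p
          ; sums       = trans (cong (λ s → suc h + s) (sums p)) (ℕP.m+[n∸m]≡n 1+h≤a) })
  (ℕP.≤-refl ∷ All.map ℕP.m≤n⇒m≤1+n b) (cong suc l)
  where
  linked : ∀ ys → Linked _>_ ys → All (_≤ h) ys → Linked _>_ (suc h ∷ ys)
  linked []      _ _         = [-]
  linked (_ ∷ _) L (y≤h ∷ _) = s≤s y≤h ∷ L

distinctParts-uncons : ∀ {k h a ys} → DistinctParts (suc k) (suc h) a (suc h ∷ ys) → DistinctParts k h (a ∸ suc h) ys
distinctParts-uncons {h = h} {a} {ys} (distinctParts p _ l) = distinctParts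
  (record { decreasing = Linked.tail (decreasing p)
          ; positive   = All.tail (positive p)
          ; sums       = trans (sym (ℕP.m+n∸m≡n (suc h) (sum ys))) (cong (_∸ suc h) (sums p)) })
  (All.map ℕP.≤-pred (head-dominates (decreasing p))) (ℕP.suc-injective l)

distinctLists-sound : ∀ k h a {xs} → xs ∈ distinctLists k h a → DistinctParts k h a xs
distinctLists-sound zero    h       zero    (here refl) =
  distinctParts (record { decreasing = [] ; positive = [] ; sums = refl }) [] refl
distinctLists-sound (suc k) (suc h) a xs∈ with suc h ≤? a | ∈-++⁻ (distinctLists (suc k) h a) xs∈
... | _         | inj₁ xs∈old = distinctParts-weaken (distinctLists-sound (suc k) h a xs∈old)
... | yes 1+h≤a | inj₂ xs∈new with ∈-map⁻ (suc h ∷_) xs∈new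
...   | ys , ys∈ , refl = distinctParts-∷ 1+h≤a (distinctLists-sound k h (a ∸ suc h) ys∈)

distinctLists-complete : ∀ k h a xs → DistinctParts k h a xs → xs ∈ distinctLists k h a
distinctLists-complete zero    h       zero    []       _ = here refl
distinctLists-complete zero    h       (suc a) []       (distinctParts p _ _) with () ← sums p
distinctLists-complete (suc k) h       a       []       (distinctParts _ _ ())
distinctLists-complete k       zero    a       (x ∷ ys) (distinctParts p (x≤0 ∷ _) _) =
  contradiction x≤0 (ℕP.<⇒≱ (All.head (positive p)))
distinctLists-complete zero    (suc h) a       (x ∷ ys) (distinctParts _ _ ())
distinctLists-complete (suc k) (suc h) a       (x ∷ ys) D@(distinctParts p (x≤1+h ∷ _) _)
  with ℕP.m≤n⇒m<n∨m≡n x≤1+h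
... | inj₁ x<1+h = ∈-++⁺ˡ (distinctLists-complete (suc k) h a (x ∷ ys) (distinctParts-strengthen (ℕP.≤-pred x<1+h) D))
... | inj₂ refl = ∈-++⁺ʳ (distinctLists (suc k) h a) (in-provided (suc h ≤? a) 1+h≤a
                    (∈-map⁺ (suc h ∷_) (distinctLists-complete k h (a ∸ suc h) ys (distinctParts-uncons D))))
  where
  1+h≤a : suc h ≤ a
  1+h≤a = subst (suc h ≤_) (sums p) (ℕP.m≤m+n (suc h) (sum ys))
  in-provided : ∀ {P : Set} (P? : Dec P) {L xs} → P → xs ∈ L → xs ∈ provided P? L
  in-provided (yes _) _ xs∈ = xs∈
  in-provided (no ¬p) p _   = contradiction p ¬p

distinctLists-unique : ∀ k h a → Unique (distinctLists k h a)
distinctLists-unique zero    h       zero    = [] ∷ []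
distinctLists-unique zero    h       (suc a) = []
distinctLists-unique (suc k) zero    a       = []
distinctLists-unique (suc k) (suc h) a with suc h ≤? a
... | no  _ = UniqueP.++⁺ (distinctLists-unique (suc k) h a) [] (λ ())
... | yes _ = UniqueP.++⁺ (distinctLists-unique (suc k) h a)
                (UniqueP.map⁺ (λ eq → proj₂ (ListP.∷-injective eq)) (distinctLists-unique k h (a ∸ suc h))) disjoint
  where
  disjoint : ∀ {xs} → ¬ (xs ∈ distinctLists (suc k) h a × xs ∈ map (suc h ∷_) (distinctLists k h (a ∸ suc h)))
  disjoint (xs∈old , xs∈new) with ∈-map⁻ (suc h ∷_) xs∈new
  ... | _ , _ , refl with bounded (distinctLists-sound (suc k) h a xs∈old)
  ...   | 1+h≤h ∷ _ = ℕP.<-irrefl refl 1+h≤h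

open Equivalence using (to; from)

length-filter-map : ∀ {A B : Set} {P : Pred A 0ℓ} {Q : Pred B 0ℓ} (P? : Decidable P) (Q? : Decidable Q) (f : B → A) →
                    (∀ y → P (f y) ⇔ Q y) → ∀ ys → length (filter P? (map f ys)) ≡ length (filter Q? ys)
length-filter-map P? Q? f P⇔Q []       = refl
length-filter-map P? Q? f P⇔Q (y ∷ ys) with P? (f y) | Q? y
... | yes _  | yes _  = cong suc (length-filter-map P? Q? f P⇔Q ys)
... | no  _  | no  _  = length-filter-map P? Q? f P⇔Q ys
... | yes p  | no ¬q  = contradiction (to (P⇔Q y) p) ¬q
... | no ¬p  | yes q  = contradiction (from (P⇔Q y) q) ¬p

-- coefficient of q^a: the number of partitions of a into k distinct parts from [1, h] satisfying P
count : {P : Pred (List ℕ) 0ℓ} → Decidable P → ℕ → ℕ → Series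
count P? k h a = + length (filter P? (distinctLists k h a))

countAll : ℕ → ℕ → Series
countAll = count U?

countCons : {P : Pred (List ℕ) 0ℓ} → Decidable P → ℕ → ℕ → ℕ → Series
countCons P? x k h a = + length (filter P? (map (x ∷_) (distinctLists k h a)))

count-split : ∀ {P} (P? : Decidable P) k h →
              count P? (suc k) (suc h) ≈ count P? (suc k) h ⊕ shift (suc h) (countCons P? (suc h) k h)
count-split P? k h a = begin
  + length (filter P? (old ++ new))                         ≡⟨ cong (λ L → + length L) (ListP.filter-++ P? old new) ⟩
  + length (filter P? old ++ filter P? new)                 ≡⟨ cong +_ (ListP.length-++ (filter P? old)) ⟩
  + (length (filter P? old) + length (filter P? new))       ≡⟨ ℤP.pos-+ (length (filter P? old)) (length (filter P? new)) ⟩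
  count P? (suc k) h a ℤ.+ + length (filter P? new)         ≡⟨ cong (λ z → count P? (suc k) h a ℤ.+ z)
                                                                     (new-count (suc h ≤? a)) ⟩
  count P? (suc k) h a ℤ.+ shift (suc h) (countCons P? (suc h) k h) a ∎
  where
  open ≡-Reasoning
  old cons new : List (List ℕ)
  old = distinctLists (suc k) h a
  cons = map (suc h ∷_) (distinctLists k h (a ∸ suc h))
  new = provided (suc h ≤? a) cons
  new-count : (d : Dec (suc h ≤ a)) → + length (filter P? (provided d cons)) ≡ shift (suc h) (countCons P? (suc h) k h) a
  new-count (yes 1+h≤a) = sym (shift-≤ (countCons P? (suc h) k h) 1+h≤a)
  new-count (no  1+h≰a) = sym (shift-< (countCons P? (suc h) k h) (ℕP.≰⇒> 1+h≰a))

count-pascal : ∀ {t P} (P? : Decidable P) → (∀ {x ys} → t < x → P (x ∷ ys) ⇔ P ys) → PascalAbove t (count P?)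
pascal-zero (count-pascal P? _) _ zero    = refl
pascal-zero (count-pascal P? _) _ (suc a) = refl
pascal-suc  (count-pascal P? P-above) {k} {h} t≤h =
  ≈-trans (count-split P? k h) (⊕-congˡ (count P? (suc k) h) (shift-cong (suc h) (λ a →
    cong +_ (length-filter-map P? P? (suc h ∷_) (λ ys → P-above (s≤s t≤h)) (distinctLists k h a)))))

countAll-pascal : PascalAbove 0 countAll
countAll-pascal = count-pascal U? (λ _ → mk⇔ (λ _ → tt) (λ _ → tt))

countAll-formula : ∀ k h → countAll k h ≈ shift (tri k) (gauss h k)
countAll-formula k h = begin
  countAll k h                          ≈⟨ ≈-reflexive (cong (countAll k) (ℕP.+-identityʳ h)) ⟨
  countAll k (h + 0)                    ≈⟨ pascalAbove-unique countAll-pascal (partsIn-pascal 0) base h k ⟩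
  partsIn 0 k (h + 0)                   ≈⟨ ≈-reflexive (cong₂ (λ e m → shift (e + tri k) (gauss m k))
                                                              (ℕP.*-zeroʳ k) (ℕP.+-identityʳ h)) ⟩
  shift (tri k) (gauss h k)             ∎
  where
  open ≈-Reasoning
  base : ∀ k → countAll k 0 ≈ partsIn 0 k 0
  base zero    = ≈-sym (≈-trans (partsIn-zero 0 0) one≈)
    where
    one≈ : one ≈ countAll 0 0
    one≈ zero    = refl
    one≈ (suc a) = refl
  base (suc k) = ≈-sym (partsIn-empty 0 k)

-- Rascoe and non-Rascoe partitions

∈-∷⇔∈ : ∀ {A : Set} {t x : A} {ys} → x ≢ t → t ∈ x ∷ ys ⇔ t ∈ ys
∈-∷⇔∈ x≢t = mk⇔ (λ { (here t≡x) → contradiction (sym t≡x) x≢t ; (there t∈ys) → t∈ys }) there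

∈-above : ∀ {t x} {ys : List ℕ} → t < x → t ∈ x ∷ ys ⇔ t ∈ ys
∈-above t<x = ∈-∷⇔∈ (λ x≡t → ℕP.<⇒≢ t<x (sym x≡t))

∉-above : ∀ {t x} {ys : List ℕ} → t < x → t ∉ x ∷ ys ⇔ t ∉ ys
∉-above t<x = mk⇔ (λ t∉ t∈ → t∉ (from (∈-above t<x) t∈)) (λ t∉ t∈ → t∉ (to (∈-above t<x) t∈))

∉-distinctLists : ∀ {t} k h a {xs} → h < t → xs ∈ distinctLists k h a → t ∉ xs
∉-distinctLists k h a h<t xs∈ t∈xs = ℕP.<⇒≱ h<t (All.lookup (bounded (distinctLists-sound k h a xs∈)) t∈xs)

count-∈-zero : ∀ t h → count (t ∈?_) 0 h ≈ 𝟘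
count-∈-zero t h zero    = refl
count-∈-zero t h (suc a) = refl

count-∈-top : ∀ h k → count (suc h ∈?_) (suc k) (suc h) ≈ shift (suc h) (countAll k h)
count-∈-top h k = begin
  count (suc h ∈?_) (suc k) (suc h)
    ≈⟨ count-split (suc h ∈?_) k h ⟩
  count (suc h ∈?_) (suc k) h ⊕ shift (suc h) (countCons (suc h ∈?_) (suc h) k h)
    ≈⟨ ⊕-cong old-none (shift-cong (suc h) new-all) ⟩
  𝟘 ⊕ shift (suc h) (countAll k h)
    ≈⟨ ⊕-identityˡ (shift (suc h) (countAll k h)) ⟩
  shift (suc h) (countAll k h) ∎
  where
  open ≈-Reasoning
  old-none : count (suc h ∈?_) (suc k) h ≈ 𝟘
  old-none a = cong (λ L → + length L) (ListP.filter-none (suc h ∈?_)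
    (All.tabulate (∉-distinctLists (suc k) h a (ℕP.n<1+n h))))
  new-all : countCons (suc h ∈?_) (suc h) k h ≈ countAll k h
  new-all a = cong +_ (length-filter-map (suc h ∈?_) U? (suc h ∷_) (λ _ → mk⇔ (λ _ → tt) (λ _ → here refl))
                                         (distinctLists k h a))

count-∉-top : ∀ h k → count (∁? (suc h ∈?_)) k (suc h) ≈ countAll k h
count-∉-top h zero    zero    = refl
count-∉-top h zero    (suc a) = refl
count-∉-top h (suc k) = begin
  count (∁? (suc h ∈?_)) (suc k) (suc h)
    ≈⟨ count-split (∁? (suc h ∈?_)) k h ⟩
  count (∁? (suc h ∈?_)) (suc k) h ⊕ shift (suc h) (countCons (∁? (suc h ∈?_)) (suc h) k h)
    ≈⟨ ⊕-cong old-all (≈-trans (shift-cong (suc h) new-none) (shift-𝟘 (suc h))) ⟩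
  countAll (suc k) h ⊕ 𝟘
    ≈⟨ ⊕-identityʳ (countAll (suc k) h) ⟩
  countAll (suc k) h ∎
  where
  open ≈-Reasoning
  old-all : count (∁? (suc h ∈?_)) (suc k) h ≈ countAll (suc k) h
  old-all a = cong (λ L → + length L) (trans
    (ListP.filter-all (∁? (suc h ∈?_)) (All.tabulate (∉-distinctLists (suc k) h a (ℕP.n<1+n h))))
    (sym (ListP.filter-all U? (All.universal (λ _ → tt) (distinctLists (suc k) h a)))))
  new-none : countCons (∁? (suc h ∈?_)) (suc h) k h ≈ 𝟘
  new-none a = cong (λ L → + length L) (ListP.filter-none (∁? (suc h ∈?_))
    (AllP.map⁺ (All.universal (λ _ 1+h∉ → 1+h∉ (here refl)) (distinctLists k h a))))

count-expand : ∀ {P} (P? : Decidable P) n → (∀ {x ys} → n < x → P (x ∷ ys) ⇔ P ys) → ∀ d →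
  count P? n (d + n) (d + n) ≡ sumSeries (suc n) (λ i → partsAbove n i ⊛ count P? (n ∸ i) n) (d + n)
count-expand P? n P-above d = begin
  count P? n N N
    ≡⟨ pascalAbove-expand (count-pascal P? P-above) d n N ⟩
  sumSeries (suc n) (λ i → partsIn n i N ⊛ count P? (n ∸ i) n) N
    ≡⟨ sumBelow-cong (suc n) (λ i _ → ⊛-agreeˡ N (count P? (n ∸ i) n) (partsIn-agree n i N) N ℕP.≤-refl) ⟩
  sumSeries (suc n) (λ i → partsAbove n i ⊛ count P? (n ∸ i) n) N ∎
  where
  open ≡-Reasoning
  N : ℕ
  N = d + n

rascoe-exponent : ∀ i r → i * suc (i + r) + tri i + (suc (i + r) + tri r) ≡ tri (suc (i + r)) + suc i * i
rascoe-exponent i r = begin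
  i * suc (i + r) + tri i + (suc (i + r) + tri r)
    ≡⟨ solve 4 (λ i r T T′ → i :* (con 1 :+ (i :+ r)) :+ T :+ ((con 1 :+ (i :+ r)) :+ T′)
                    := (con 1 :+ i :+ T) :+ T′ :+ (con 1 :+ i) :* r :+ (con 1 :+ i) :* i) refl i r (tri i) (tri r) ⟩
  (suc i + tri i) + tri r + suc i * r + suc i * i
    ≡⟨ cong (λ x → x + tri r + suc i * r + suc i * i) (tri-suc i) ⟨
  tri (suc i) + tri r + suc i * r + suc i * i
    ≡⟨ cong (_+ suc i * i) (tri-+ (suc i) r) ⟨
  tri (suc (i + r)) + suc i * i ∎
  where
  open ≡-Reasoning
  open ℕSolver.+-*-Solver

nonRascoe-exponent : ∀ i r → suc i * suc (i + r) + tri (suc i) + tri r ≡ tri (suc (i + r)) + suc i * suc i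
nonRascoe-exponent i r = begin
  suc i * suc (i + r) + tri (suc i) + tri r
    ≡⟨ solve 4 (λ i r T T′ → (con 1 :+ i) :* (con 1 :+ (i :+ r)) :+ T :+ T′
                    := T :+ T′ :+ (con 1 :+ i) :* r :+ (con 1 :+ i) :* (con 1 :+ i)) refl i r (tri (suc i)) (tri r) ⟩
  tri (suc i) + tri r + suc i * r + suc i * suc i
    ≡⟨ cong (_+ suc i * suc i) (tri-+ (suc i) r) ⟨
  tri (suc (i + r)) + suc i * suc i ∎
  where
  open ≡-Reasoning
  open ℕSolver.+-*-Solver

partsAbove-⊛-shift : ∀ t k e s g → k * t + tri k + e ≡ tri t + s →
                     partsAbove t k ⊛ shift e g ≈ shift (tri t) (g ⊛ shift s (invQPoch k))
partsAbove-⊛-shift t k e s g exponent = begin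
  partsAbove t k ⊛ shift e g                ≈⟨ shift-⊛-shift (k * t + tri k) e (invQPoch k) g ⟩
  shift (k * t + tri k + e) (invQPoch k ⊛ g) ≈⟨ ≈-reflexive (cong (λ x → shift x (invQPoch k ⊛ g)) exponent) ⟩
  shift (tri t + s) (invQPoch k ⊛ g)        ≈⟨ shift-cong (tri t + s) (⊛-comm (invQPoch k) g) ⟩
  shift (tri t + s) (g ⊛ invQPoch k)        ≈⟨ shift-⊛-shiftʳ (tri t) s g (invQPoch k) ⟨
  shift (tri t) (g ⊛ shift s (invQPoch k))  ∎
  where open ≈-Reasoning

rascoe-series : ∀ m →
  sumSeries (suc (suc m)) (λ i → partsAbove (suc m) i ⊛ count (suc m ∈?_) (suc m ∸ i) (suc m)) ≈ termA (suc m)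
rascoe-series m = begin
  sumSeries (suc n) G                   ≈⟨ ⊕-congˡ (sumSeries n G) last≈𝟘 ⟩
  sumSeries n G ⊕ 𝟘                     ≈⟨ ⊕-identityʳ (sumSeries n G) ⟩
  sumSeries n G                         ≈⟨ sumSeries-cong n (λ i i<n → summand i (ℕP.≤-pred i<n)) ⟩
  sumSeries n (λ i → shift (tri n) (F i)) ≈⟨ shift-sumSeries (tri n) n F ⟨
  termA n                               ∎
  where
  open ≈-Reasoning
  n : ℕ
  n = suc m
  G F : ℕ → Series
  G i = partsAbove n i ⊛ count (n ∈?_) (n ∸ i) n
  F i = gauss m i ⊛ shift (suc i * i) (invQPoch i)
  last≈𝟘 : G n ≈ 𝟘
  last≈𝟘 = ≈-trans (⊛-congˡ (partsAbove n n) (≈-trans (≈-reflexive (cong (λ k → count (n ∈?_) k n) (ℕP.n∸n≡0 n)))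
                                                       (count-∈-zero n n)))
                   (⊛-zeroʳ (partsAbove n n))
  summand : ∀ i → i ≤ m → G i ≈ shift (tri n) (F i)
  summand i i≤m = begin
    partsAbove n i ⊛ count (n ∈?_) (n ∸ i) n
      ≈⟨ ⊛-congˡ (partsAbove n i) (≈-reflexive (cong (λ k → count (n ∈?_) k n) (ℕP.+-∸-assoc 1 i≤m))) ⟩
    partsAbove n i ⊛ count (n ∈?_) (suc (m ∸ i)) n
      ≈⟨ ⊛-congˡ (partsAbove n i) (≈-trans (count-∈-top m (m ∸ i)) (shift-cong n (countAll-formula (m ∸ i) m))) ⟩
    partsAbove n i ⊛ shift n (shift (tri (m ∸ i)) (gauss m (m ∸ i)))
      ≈⟨ ⊛-congˡ (partsAbove n i) (≈-trans (shift-+ n (tri (m ∸ i)) (gauss m (m ∸ i)))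
                                           (shift-cong (n + tri (m ∸ i)) (gauss-sym i≤m))) ⟩
    partsAbove n i ⊛ shift (n + tri (m ∸ i)) (gauss m i)
      ≈⟨ partsAbove-⊛-shift n i (n + tri (m ∸ i)) (suc i * i) (gauss m i) exponent ⟩
    shift (tri n) (F i) ∎
    where
    exponent : i * n + tri i + (n + tri (m ∸ i)) ≡ tri n + suc i * i
    exponent = subst (λ M → i * suc M + tri i + (suc M + tri (m ∸ i)) ≡ tri (suc M) + suc i * i)
                     (ℕP.m+[n∸m]≡n i≤m) (rascoe-exponent i (m ∸ i))

nonRascoe-series : ∀ m →
  sumSeries (suc (suc m)) (λ i → partsAbove (suc m) i ⊛ count (∁? (suc m ∈?_)) (suc m ∸ i) (suc m)) ≈ termB (suc m)
nonRascoe-series m = begin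
  sumSeries (suc n) G                     ≈⟨ sumSeries-head n G ⟩
  G 0 ⊕ sumSeries n (G ∘ suc)             ≈⟨ ⊕-congʳ (sumSeries n (G ∘ suc)) first≈𝟘 ⟩
  𝟘 ⊕ sumSeries n (G ∘ suc)               ≈⟨ ⊕-identityˡ (sumSeries n (G ∘ suc)) ⟩
  sumSeries n (G ∘ suc)                   ≈⟨ sumSeries-cong n (λ j j<n → summand j (ℕP.≤-pred j<n)) ⟩
  sumSeries n (λ j → shift (tri n) (F j)) ≈⟨ shift-sumSeries (tri n) n F ⟨
  termB n                                 ∎
  where
  open ≈-Reasoning
  n : ℕ
  n = suc m
  G F : ℕ → Series
  G i = partsAbove n i ⊛ count (∁? (n ∈?_)) (n ∸ i) n
  F j = gauss m j ⊛ shift (suc j * suc j) (invQPoch (suc j))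
  first≈𝟘 : G 0 ≈ 𝟘
  first≈𝟘 = ≈-trans (⊛-congˡ (partsAbove n 0)
                       (≈-trans (count-∉-top m n) (≈-trans (countAll-formula n m)
                                (≈-trans (shift-cong (tri n) (gauss-> m n (ℕP.n<1+n m))) (shift-𝟘 (tri n))))))
                    (⊛-zeroʳ (partsAbove n 0))
  summand : ∀ j → j ≤ m → G (suc j) ≈ shift (tri n) (F j)
  summand j j≤m = begin
    partsAbove n (suc j) ⊛ count (∁? (n ∈?_)) (m ∸ j) n
      ≈⟨ ⊛-congˡ (partsAbove n (suc j)) (≈-trans (count-∉-top m (m ∸ j)) (countAll-formula (m ∸ j) m)) ⟩
    partsAbove n (suc j) ⊛ shift (tri (m ∸ j)) (gauss m (m ∸ j))
      ≈⟨ ⊛-congˡ (partsAbove n (suc j)) (shift-cong (tri (m ∸ j)) (gauss-sym j≤m)) ⟩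
    partsAbove n (suc j) ⊛ shift (tri (m ∸ j)) (gauss m j)
      ≈⟨ partsAbove-⊛-shift n (suc j) (tri (m ∸ j)) (suc j * suc j) (gauss m j) exponent ⟩
    shift (tri n) (F j) ∎
    where
    exponent : suc j * n + tri (suc j) + tri (m ∸ j) ≡ tri n + suc j * suc j
    exponent = subst (λ M → suc j * suc M + tri (suc j) + tri (m ∸ j) ≡ tri (suc M) + suc j * suc j)
                     (ℕP.m+[n∸m]≡n j≤m) (nonRascoe-exponent j (m ∸ j))

∈⇒≤sum : ∀ {x} xs → x ∈ xs → x ≤ sum xs
∈⇒≤sum (y ∷ ys) (here refl) = ℕP.m≤m+n y (sum ys)
∈⇒≤sum (y ∷ ys) (there x∈) = ℕP.≤-trans (∈⇒≤sum ys x∈) (ℕP.m≤n+m (sum ys) y)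

length≤sum : ∀ {xs} → All (1 ≤_) xs → length xs ≤ sum xs
length≤sum []             = z≤n
length≤sum (1≤x ∷ 1≤xs) = ℕP.+-mono-≤ 1≤x (length≤sum 1≤xs)

nonempty : ∀ xs → 1 ≤ sum xs → 1 ≤ length xs
nonempty []      ()
nonempty (_ ∷ _) _ = s≤s z≤n

distinctPartition⇒distinctParts : ∀ {N xs} → DistinctPartition N xs → DistinctParts (length xs) N N xs
distinctPartition⇒distinctParts {xs = xs} p =
  distinctParts p (All.tabulate (λ x∈ → subst (_ ≤_) (sums p) (∈⇒≤sum xs x∈))) refl

module Enumeration (Q : ℕ → List ℕ → Set) (Q? : ∀ n → Decidable (Q n)) (N : ℕ) where

  withParts : ℕ → List (List ℕ)
  withParts n = filter (Q? n) (distinctLists n N N)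

  withPartsUpTo : ℕ → List (List ℕ)
  withPartsUpTo zero    = []
  withPartsUpTo (suc m) = withPartsUpTo m ++ withParts (suc m)

  withParts-length : ∀ {n xs} → xs ∈ withParts n → length xs ≡ n
  withParts-length {n} xs∈ = parts (distinctLists-sound n N N (proj₁ (∈-filter⁻ (Q? n) xs∈)))

  withPartsUpTo-length : ∀ m {xs} → xs ∈ withPartsUpTo m → length xs ≤ m
  withPartsUpTo-length (suc m) xs∈ with ∈-++⁻ (withPartsUpTo m) xs∈
  ... | inj₁ xs∈old = ℕP.m≤n⇒m≤1+n (withPartsUpTo-length m xs∈old)
  ... | inj₂ xs∈new = ℕP.≤-reflexive (withParts-length xs∈new)

  withPartsUpTo-unique : ∀ m → Unique (withPartsUpTo m)
  withPartsUpTo-unique zero    = []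
  withPartsUpTo-unique (suc m) =
    UniqueP.++⁺ (withPartsUpTo-unique m) (UniqueP.filter⁺ (Q? (suc m)) (distinctLists-unique (suc m) N N))
    (λ (xs∈old , xs∈new) → ℕP.<-irrefl (withParts-length xs∈new) (s≤s (withPartsUpTo-length m xs∈old)))

  withPartsUpTo-count : ∀ m → + length (withPartsUpTo m) ≡ sumBelow m (λ i → count (Q? (suc i)) (suc i) N N)
  withPartsUpTo-count zero    = refl
  withPartsUpTo-count (suc m) = trans (cong +_ (ListP.length-++ (withPartsUpTo m)))
    (trans (ℤP.pos-+ (length (withPartsUpTo m)) (length (withParts (suc m))))
           (cong (ℤ._+ count (Q? (suc m)) (suc m) N N) (withPartsUpTo-count m)))

  withPartsUpTo⁺ : ∀ m {n xs} → 1 ≤ n → n ≤ m → xs ∈ withParts n → xs ∈ withPartsUpTo m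
  withPartsUpTo⁺ zero    1≤n n≤0 _ = contradiction n≤0 (ℕP.<⇒≱ 1≤n)
  withPartsUpTo⁺ (suc m) {n} 1≤n n≤1+m xs∈ with ℕP.m≤n⇒m<n∨m≡n n≤1+m
  ... | inj₁ n≤m = ∈-++⁺ˡ (withPartsUpTo⁺ m 1≤n (ℕP.≤-pred n≤m) xs∈)
  ... | inj₂ refl = ∈-++⁺ʳ (withPartsUpTo m) xs∈

  withPartsUpTo⁻ : ∀ m {xs} → xs ∈ withPartsUpTo m → Σ ℕ (λ n → xs ∈ withParts n)
  withPartsUpTo⁻ (suc m) xs∈ with ∈-++⁻ (withPartsUpTo m) xs∈
  ... | inj₁ xs∈old = withPartsUpTo⁻ m xs∈old
  ... | inj₂ xs∈new = suc m , xs∈new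

  Partition : List ℕ → Set
  Partition xs = DistinctPartition N xs × Q (length xs) xs

  withPartsUpTo-sound : ∀ {xs} → xs ∈ withPartsUpTo N → Partition xs
  withPartsUpTo-sound xs∈ with withPartsUpTo⁻ N xs∈
  ... | n , xs∈n with ∈-filter⁻ (Q? n) xs∈n
  ...   | xs∈′ , q with distinctLists-sound n N N xs∈′
  ...     | distinctParts p _ refl = p , q

  withPartsUpTo-complete : 1 ≤ N → ∀ {xs} → Partition xs → xs ∈ withPartsUpTo N
  withPartsUpTo-complete 1≤N {xs} (p , q) = withPartsUpTo⁺ N 1≤length length≤N
    (∈-filter⁺ (Q? (length xs)) (distinctLists-complete (length xs) N N xs (distinctPartition⇒distinctParts p)) q)
    where
    length≤N : length xs ≤ N
    length≤N = subst (length xs ≤_) (sums p) (length≤sum (positive p))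
    1≤length : 1 ≤ length xs
    1≤length = nonempty xs (subst (1 ≤_) (sym (sums p)) 1≤N)

  hasCount : 1 ≤ N → HasCount Partition (sumBelow N (λ i → count (Q? (suc i)) (suc i) N N))
  hasCount 1≤N = withPartsUpTo N , withPartsUpTo-unique N ,
    (λ xs → mk⇔ withPartsUpTo-sound (withPartsUpTo-complete 1≤N)) , withPartsUpTo-count N

rascoe-coefficient : ∀ m d → count (suc m ∈?_) (suc m) (d + suc m) (d + suc m) ≡ termA (suc m) (d + suc m)
rascoe-coefficient m d = trans (count-expand (suc m ∈?_) (suc m) ∈-above d) (rascoe-series m (d + suc m))

nonRascoe-coefficient : ∀ m d → count (∁? (suc m ∈?_)) (suc m) (d + suc m) (d + suc m) ≡ termB (suc m) (d + suc m)
nonRascoe-coefficient m d = trans (count-expand (∁? (suc m ∈?_)) (suc m) ∉-above d) (nonRascoe-series m (d + suc m))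

sumBelow-coefficients : ∀ {Q : ℕ → List ℕ → Set} (Q? : ∀ n → Decidable (Q n)) (T : ℕ → Series) →
  (∀ m d → count (Q? (suc m)) (suc m) (d + suc m) (d + suc m) ≡ T (suc m) (d + suc m)) →
  ∀ N → sumBelow N (λ i → count (Q? (suc i)) (suc i) N N) ≡ infSum1 T N
sumBelow-coefficients Q? T count≡T N = sumBelow-cong N (λ i i<N →
  subst (λ M → count (Q? (suc i)) (suc i) M M ≡ T (suc i) M) (ℕP.m∸n+n≡m i<N) (count≡T i (N ∸ suc i)))

theorem2p2 : ((N : ℕ) → 1 ≤ N → HasCount (Rascoe N) (rhsA N)) × (rhsA 0 ≡ + 0)
           × ((N : ℕ) → 1 ≤ N → HasCount (NonRascoe N) (rhsB N)) × (rhsB 0 ≡ + 0)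
theorem2p2 = rascoe , refl , nonRascoe , refl
  where
  rascoe : ∀ N → 1 ≤ N → HasCount (Rascoe N) (rhsA N)
  rascoe N 1≤N = subst (HasCount (Rascoe N)) (sumBelow-coefficients (λ n → n ∈?_) termA rascoe-coefficient N)
                       (Enumeration.hasCount _∈_ (λ n → n ∈?_) N 1≤N)
  nonRascoe : ∀ N → 1 ≤ N → HasCount (NonRascoe N) (rhsB N)
  nonRascoe N 1≤N = subst (HasCount (NonRascoe N)) (sumBelow-coefficients (λ n → ∁? (n ∈?_)) termB nonRascoe-coefficient N)
                          (Enumeration.hasCount _∉_ (λ n → ∁? (n ∈?_)) N 1≤N)
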